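{- Let $p$ be an odd prime. For $x\geq1$, $$\#\{A\in M(2,\mathbb{Z}):\ h(A)\leq x,\ \det A\not\equiv 0\pmod p\}=16\gamma_p x^4+O(x^3),$$ where $\gamma_p=1-\frac1p-\frac1{p^2}+\frac1{p^3}$, with an absolute implied constant.
   Context: For $A=(a_{ij})\in M(2,\mathbb{Z})$, $h(A)=\max_{i,j}|a_{ij}|$.
   Formalization: The height bound x ranges over the rationals with x ≥ 1. -}

module Defs where

open import Data.Nat as ℕ using (ℕ; zero; suc)
open import Data.Integer as ℤ using (ℤ; +_)
open import Data.Integer.Divisibility as ℤD using ()
open import Data.Nat.Divisibility as ℕD using ()
open import Data.Rational as ℚ using (ℚ; ceiling)
open import Data.Rational.Properties as ℚP using ()
open import Data.Fin using (Fin; zero; suc)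
open import Data.List using (List; _∷_; []; map; upTo; concatMap; filter; length)
open import Data.Product using (_×_)
open import Relation.Nullary using (Dec; ¬_; ¬?; _×-dec_)

M2 : Set
M2 = Fin 2 → Fin 2 → ℤ

mk : ℤ → ℤ → ℤ → ℤ → M2
mk a b c d zero    zero    = a
mk a b c d zero    (suc _) = b
mk a b c d (suc _) zero    = c
mk a b c d (suc _) (suc _) = d

det : M2 → ℤ
det A = A zero zero ℤ.* A (suc zero) (suc zero) ℤ.- A zero (suc zero) ℤ.* A (suc zero) zero

h : M2 → ℕ
h A = ℤ.∣ A zero zero ∣ ℕ.⊔ ℤ.∣ A zero (suc zero) ∣ ℕ.⊔ ℤ.∣ A (suc zero) zero ∣ ℕ.⊔ ℤ.∣ A (suc zero) (suc zero) ∣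

range : ℕ → List ℤ
range n = map (λ k → + k ℤ.- + n) (upTo (suc (2 ℕ.* n)))

box : ℕ → List M2
box n = concatMap (λ a → concatMap (λ b → concatMap (λ c → map (λ d → mk a b c d) (range n)) (range n)) (range n)) (range n)

Cond : ℕ → ℚ → M2 → Set
Cond p x A = (ℚ._≤_ (+ h A ℚ./ 1) x) × ¬ (+ p ℤD.∣ det A)

Cond? : (p : ℕ) (x : ℚ) (A : M2) → Dec (Cond p x A)
Cond? p x A = (+ h A ℚ./ 1 ℚP.≤? x) ×-dec ¬? (p ℕD.∣? ℤ.∣ det A ∣)

-- #{A ∈ M(2,ℤ) : h(A) ≤ x, det A ≢ 0 mod p}.
-- Every A with h(A) ≤ x has entries in [-⌈x⌉, ⌈x⌉], so enumerating this box
-- (and filtering by the condition) counts exactly the set.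
count : ℕ → ℚ → ℕ
count p x = length (filter (Cond? p x) (box ℤ.∣ ceiling x ∣))

-- 1/n as a rational (junk value 0 at n = 0; only used for primes)
inv : ℕ → ℚ
inv zero    = ℚ.0ℚ
inv (suc n) = + 1 ℚ./ suc n

γ : ℕ → ℚ
γ p = ℚ.1ℚ ℚ.- inv p ℚ.- inv (p ℕ.^ 2) ℚ.+ inv (p ℕ.^ 3)

_^ℚ_ : ℚ → ℕ → ℚ
q ^ℚ zero  = ℚ.1ℚ
q ^ℚ suc k = q ℚ.* (q ^ℚ k)

{-# OPTIONS --safe #-}
-- Let m = ⌊x⌋ and N = 2m + 1, so that the count runs over the matrices with entries in [-m, m].
-- If p ∤ u, the congruence u k + v ≡ 0 (mod p) has exactly one solution in any p consecutive
-- integers, hence N/p + O(1) solutions in [-m, m]. Counting in this way the (c, d) with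
-- p ∣ ad - bc for fixed (a, b), the number S of matrices with p ∣ det satisfies
-- pS = N⁴ + (p - 1) N² z² + O(pN³), where z = N/p + O(1) is the number of multiples of p in
-- [-m, m]. Hence p³ (N⁴ - S) = p³ γ_p N⁴ + O(p³ N³), and replacing N by 2x costs O(x³).
module Submission where

open import Defs

module Distance where
  open import Data.Nat.Base using (zero; suc; _+_; _*_; _≤_; ∣_-_∣)
  open import Data.Nat.Properties
  open import Data.Nat.Tactic.RingSolver using (solve-∀)
  open import Data.Integer as ℤ using (ℤ; +_; _⊖_)
  import Data.Integer.Properties as ℤP
  open import Relation.Binary.PropositionalEquality

  ∣a+b-c+d∣≤∣a-c∣+∣b-d∣ : ∀ a b c d → ∣ a + b - c + d ∣ ≤ ∣ a - c ∣ + ∣ b - d ∣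
  ∣a+b-c+d∣≤∣a-c∣+∣b-d∣ a b c d = begin
    ∣ a + b - c + d ∣                      ≤⟨ ∣-∣-triangle (a + b) (c + b) (c + d) ⟩
    ∣ a + b - c + b ∣ + ∣ c + b - c + d ∣  ≡⟨ cong₂ _+_ (trans (cong₂ ∣_-_∣ (+-comm a b) (+-comm c b)) (∣m+n-m+o∣≡∣n-o∣ b a c))
                                                        (∣m+n-m+o∣≡∣n-o∣ c b d) ⟩
    ∣ a - c ∣ + ∣ b - d ∣                  ∎
    where open ≤-Reasoning

  ∣-∣-transfer : ∀ {a b c d} → a + b ≡ c + d → ∣ a - c ∣ ≡ ∣ d - b ∣
  ∣-∣-transfer {a} {b} {c} {d} a+b≡c+d = begin
    ∣ a - c ∣             ≡⟨ ∣m+n-m+o∣≡∣n-o∣ b a c ⟨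
    ∣ b + a - b + c ∣     ≡⟨ cong₂ ∣_-_∣ (trans (+-comm b a) a+b≡c+d) (+-comm b c) ⟩
    ∣ c + d - c + b ∣     ≡⟨ ∣m+n-m+o∣≡∣n-o∣ c d b ⟩
    ∣ d - b ∣             ∎
    where open ≡-Reasoning

  ∣m*m-n*n∣≡∣m-n∣*[m+n] : ∀ m n → ∣ m * m - n * n ∣ ≡ ∣ m - n ∣ * (m + n)
  ∣m*m-n*n∣≡∣m-n∣*[m+n] m n = begin
    ∣ m * m - n * n ∣                     ≡⟨ ∣m+n-m+o∣≡∣n-o∣ (m * n) (m * m) (n * n) ⟨
    ∣ m * n + m * m - m * n + n * n ∣     ≡⟨ cong₂ ∣_-_∣ (lemma₁ m n) (lemma₂ m n) ⟩
    ∣ (m + n) * m - (m + n) * n ∣         ≡⟨ *-distribˡ-∣-∣ (m + n) m n ⟨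
    (m + n) * ∣ m - n ∣                   ≡⟨ *-comm (m + n) _ ⟩
    ∣ m - n ∣ * (m + n)                   ∎
    where
    open ≡-Reasoning
    lemma₁ : ∀ m n → m * n + m * m ≡ (m + n) * m
    lemma₁ = solve-∀
    lemma₂ : ∀ m n → m * n + n * n ≡ (m + n) * n
    lemma₂ = solve-∀

  ∣-∣≡∣+-+∣ : ∀ m n → ∣ m - n ∣ ≡ ℤ.∣ + m ℤ.- + n ∣
  ∣-∣≡∣+-+∣ m n = trans (∣-∣≡∣⊖∣ m n) (cong ℤ.∣_∣ (sym (ℤP.m-n≡m⊖n m n)))
    where
    ∣-∣≡∣⊖∣ : ∀ m n → ∣ m - n ∣ ≡ ℤ.∣ m ⊖ n ∣
    ∣-∣≡∣⊖∣ zero    zero    = refl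
    ∣-∣≡∣⊖∣ zero    (suc n) = refl
    ∣-∣≡∣⊖∣ (suc m) zero    = refl
    ∣-∣≡∣⊖∣ (suc m) (suc n) = trans (∣-∣≡∣⊖∣ m n) (cong ℤ.∣_∣ (sym (ℤP.[1+m]⊖[1+n]≡m⊖n m n)))

open Distance

module Sums where
  open import Data.Nat.Base using (ℕ; zero; suc; _+_; _*_; _^_; _∸_; _≤_; _<_; z≤n; s≤s; ∣_-_∣; NonZero)
  open import Data.Nat.Properties
  open import Data.Nat.DivMod using (_/_; _%_; m≡m%n+[m/n]*n; m%n≤n)
  open import Data.Integer as ℤ using (ℤ; +_)
  import Data.Integer.Properties as ℤP
  open import Data.Integer.Tactic.RingSolver using (solve-∀)
  open import Function using (_⇔_; Equivalence)
  open import Relation.Nullary using (Dec; yes; no; ¬_; ¬?; _×-dec_)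
  open import Relation.Nullary.Negation using (contradiction)
  open import Relation.Binary.PropositionalEquality
  open import Algebra.Properties.CommutativeSemigroup +-commutativeSemigroup
    using () renaming (interchange to +-interchange)

  𝟙 : {P : Set} → Dec P → ℕ
  𝟙 (yes _) = 1
  𝟙 (no _)  = 0

  𝟙-yes : {P : Set} (P? : Dec P) → P → 𝟙 P? ≡ 1
  𝟙-yes (yes _) _  = refl
  𝟙-yes (no ¬p) p = contradiction p ¬p

  𝟙-no : {P : Set} (P? : Dec P) → ¬ P → 𝟙 P? ≡ 0
  𝟙-no (yes p) ¬p = contradiction p ¬p
  𝟙-no (no _)  _  = refl

  𝟙-cong : {P Q : Set} (P? : Dec P) (Q? : Dec Q) → P ⇔ Q → 𝟙 P? ≡ 𝟙 Q?
  𝟙-cong P? (yes q) P⇔Q = 𝟙-yes P? (Equivalence.from P⇔Q q)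
  𝟙-cong P? (no ¬q) P⇔Q = 𝟙-no P? (λ p → ¬q (Equivalence.to P⇔Q p))

  𝟙-× : {P Q : Set} (P? : Dec P) (Q? : Dec Q) → 𝟙 (P? ×-dec Q?) ≡ 𝟙 P? * 𝟙 Q?
  𝟙-× (yes _) (yes _) = refl
  𝟙-× (yes _) (no _)  = refl
  𝟙-× (no _)  _       = refl

  𝟙-¬ : {P : Set} (P? : Dec P) → 𝟙 (¬? P?) + 𝟙 P? ≡ 1
  𝟙-¬ (yes _) = refl
  𝟙-¬ (no _)  = refl

  ∑< : ℕ → (ℕ → ℕ) → ℕ
  ∑< zero    f = 0
  ∑< (suc L) f = f 0 + ∑< L (λ i → f (suc i))

  ∑<-cong : ∀ {f g} L → (∀ i → f i ≡ g i) → ∑< L f ≡ ∑< L g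
  ∑<-cong zero    f≗g = refl
  ∑<-cong (suc L) f≗g = cong₂ _+_ (f≗g 0) (∑<-cong L (λ i → f≗g (suc i)))

  ∑<-+ : ∀ {f g} L → ∑< L (λ i → f i + g i) ≡ ∑< L f + ∑< L g
  ∑<-+ zero    = refl
  ∑<-+ {f} {g} (suc L) = trans (cong (λ t → f 0 + g 0 + t) (∑<-+ L)) (+-interchange (f 0) (g 0) _ _)

  ∑<-*ˡ : ∀ {f} c L → ∑< L (λ i → c * f i) ≡ c * ∑< L f
  ∑<-*ˡ     c zero    = sym (*-zeroʳ c)
  ∑<-*ˡ {f} c (suc L) = trans (cong (λ t → c * f 0 + t) (∑<-*ˡ c L)) (sym (*-distribˡ-+ c (f 0) _))

  ∑<-const : ∀ c L → ∑< L (λ _ → c) ≡ L * c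
  ∑<-const c zero    = refl
  ∑<-const c (suc L) = cong (λ t → c + t) (∑<-const c L)

  ∑<-++ : ∀ {f} a b → ∑< (a + b) f ≡ ∑< a f + ∑< b (λ i → f (a + i))
  ∑<-++     zero    b = refl
  ∑<-++ {f} (suc a) b = trans (cong (λ t → f 0 + t) (∑<-++ a b)) (sym (+-assoc (f 0) _ _))

  ∑<-zero : ∀ {f} L → (∀ j → j < L → f j ≡ 0) → ∑< L f ≡ 0
  ∑<-zero zero    _   = refl
  ∑<-zero (suc L) f≡0 = cong₂ _+_ (f≡0 0 (s≤s z≤n)) (∑<-zero L λ j j<L → f≡0 (suc j) (s≤s j<L))

  ∑<-single : ∀ {f} L {i₀} → i₀ < L → f i₀ ≡ 1 → (∀ j → j < L → j ≢ i₀ → f j ≡ 0) → ∑< L f ≡ 1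
  ∑<-single (suc L) {zero} _ f0≡1 f≡0 =
    cong₂ _+_ f0≡1 (∑<-zero L λ j j<L → f≡0 (suc j) (s≤s j<L) λ ())
  ∑<-single (suc L) {suc i₀} (s≤s i₀<L) fi₀≡1 f≡0 =
    cong₂ _+_ (f≡0 0 (s≤s z≤n) λ ()) (∑<-single L i₀<L fi₀≡1 λ j j<L j≢i₀ → f≡0 (suc j) (s≤s j<L) (λ e → j≢i₀ (suc-injective e)))

  ∑<-dist : ∀ {f g e} L → (∀ i → ∣ f i - g i ∣ ≤ e) → ∣ ∑< L f - ∑< L g ∣ ≤ L * e
  ∑<-dist zero    _     = z≤n
  ∑<-dist {f} {g} (suc L) f≈g = ≤-trans (∣a+b-c+d∣≤∣a-c∣+∣b-d∣ (f 0) _ (g 0) _)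
                                       (+-mono-≤ (f≈g 0) (∑<-dist L (λ i → f≈g (suc i))))

  window : (ℤ → ℕ) → ℤ → ℕ → ℕ
  window f s L = ∑< L (λ i → f (s ℤ.+ + i))

  window-++ : ∀ f s a b → window f s (a + b) ≡ window f s a + window f (s ℤ.+ + a) b
  window-++ f s a b = trans (∑<-++ a b) (cong (λ t → window f s a + t) (∑<-cong b λ i → cong f (shift i)))
    where
    shift : ∀ i → s ℤ.+ + (a + i) ≡ s ℤ.+ + a ℤ.+ + i
    shift i = trans (cong (λ t → s ℤ.+ t) (ℤP.pos-+ a i)) (sym (ℤP.+-assoc s (+ a) (+ i)))

  window-1 : ∀ f s → window f s 1 ≡ f s
  window-1 f s = trans (+-identityʳ _) (cong f (ℤP.+-identityʳ s))

  window-ends : ∀ f s L → window f s (suc (L + 1)) ≡ f s + (window f (s ℤ.+ + 1) L + f (s ℤ.+ + 1 ℤ.+ + L))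
  window-ends f s L = begin
    window f s (1 + (L + 1))                                        ≡⟨ window-++ f s 1 (L + 1) ⟩
    window f s 1 + window f (s ℤ.+ + 1) (L + 1)                     ≡⟨ cong₂ _+_ (window-1 f s) (window-++ f (s ℤ.+ + 1) L 1) ⟩
    f s + (window f (s ℤ.+ + 1) L + window f (s ℤ.+ + 1 ℤ.+ + L) 1) ≡⟨ cong (λ t → f s + (window f (s ℤ.+ + 1) L + t)) (window-1 f _) ⟩
    f s + (window f (s ℤ.+ + 1) L + f (s ℤ.+ + 1 ℤ.+ + L))          ∎
    where open ≡-Reasoning

  window-count : ∀ {p} .{{_ : NonZero p}} f → (∀ s → window f s p ≡ 1) →
                 ∀ s L → ∣ p * window f s L - L ∣ ≤ p
  window-count {p} f periodic s L =
    subst (λ L → ∣ p * window f s L - L ∣ ≤ p) (sym L≡) (full (L / p) s (L % p) (m%n≤n L p))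
    where
    L≡ : L ≡ L / p * p + L % p
    L≡ = trans (m≡m%n+[m/n]*n L p) (+-comm (L % p) _)

    short : ∀ s r → r ≤ p → ∣ p * window f s r - r ∣ ≤ p
    short s r r≤p = ≤-trans (∣m-n∣≤m⊔n _ r) (⊔-lub (≤-trans (*-monoʳ-≤ p w≤1) (≤-reflexive (*-identityʳ p))) r≤p)
      where
      w≤1 : window f s r ≤ 1
      w≤1 = subst (window f s r ≤_) (trans (cong (window f s) (m+[n∸m]≡n r≤p)) (periodic s))
                  (subst (window f s r ≤_) (sym (window-++ f s r _)) (m≤m+n _ _))

    full : ∀ q s r → r ≤ p → ∣ p * window f s (q * p + r) - (q * p + r) ∣ ≤ p
    full zero    s r r≤p = short s r r≤p
    full (suc q) s r r≤p = begin
      ∣ p * window f s (p + q * p + r) - (p + q * p + r) ∣    ≡⟨ cong (λ L → ∣ p * window f s L - L ∣) (+-assoc p (q * p) r) ⟩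
      ∣ p * window f s (p + L′) - (p + L′) ∣                  ≡⟨ cong (λ w → ∣ p * w - p + L′ ∣)
                                                                     (trans (window-++ f s p L′) (cong (_+ w′) (periodic s))) ⟩
      ∣ p * suc w′ - p + L′ ∣                                 ≡⟨ cong (λ t → ∣ t - p + L′ ∣) (*-suc p w′) ⟩
      ∣ p + p * w′ - p + L′ ∣                                 ≡⟨ ∣m+n-m+o∣≡∣n-o∣ p _ L′ ⟩
      ∣ p * w′ - L′ ∣                                         ≤⟨ full q (s ℤ.+ + p) r r≤p ⟩
      p                                                       ∎
      where
      open ≤-Reasoning
      L′ = q * p + r
      w′ = window f (s ℤ.+ + p) L′

  -- Opaque so that its lemmas can be applied without unification unfolding the sum.
  opaque
    ∑± : ℕ → (ℤ → ℕ) → ℕ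
    ∑± m f = window f (ℤ.- + m) (suc (2 * m))

  module ∑±-Properties (m : ℕ) where
    private variable f g : ℤ → ℕ

    opaque
      unfolding ∑±

      ∑±-cong : (∀ k → f k ≡ g k) → ∑± m f ≡ ∑± m g
      ∑±-cong f≗g = ∑<-cong (suc (2 * m)) (λ i → f≗g (ℤ.- + m ℤ.+ + i))

      ∑±-+ : ∑± m (λ k → f k + g k) ≡ ∑± m f + ∑± m g
      ∑±-+ {f} {g} = ∑<-+ {λ i → f (ℤ.- + m ℤ.+ + i)} {λ i → g (ℤ.- + m ℤ.+ + i)} (suc (2 * m))

      ∑±-*ˡ : ∀ c → ∑± m (λ k → c * f k) ≡ c * ∑± m f
      ∑±-*ˡ {f} c = ∑<-*ˡ {λ i → f (ℤ.- + m ℤ.+ + i)} c (suc (2 * m))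

      ∑±-const : ∀ c → ∑± m (λ _ → c) ≡ suc (2 * m) * c
      ∑±-const c = ∑<-const c (suc (2 * m))

      ∑±-dist : ∀ {e} → (∀ k → ∣ f k - g k ∣ ≤ e) → ∣ ∑± m f - ∑± m g ∣ ≤ suc (2 * m) * e
      ∑±-dist {f} {g} f≈g = ∑<-dist {λ i → f (ℤ.- + m ℤ.+ + i)} {λ i → g (ℤ.- + m ℤ.+ + i)} (suc (2 * m))
                                    (λ i → f≈g (ℤ.- + m ℤ.+ + i))

  opaque
    unfolding ∑±

    ∑±≡window : ∀ m f → ∑± m f ≡ window f (ℤ.- + m) (suc (2 * m))
    ∑±≡window m f = refl

    ∑±-zero : ∀ f → ∑± 0 f ≡ f (+ 0)
    ∑±-zero f = window-1 f (+ 0)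

    ∑±-suc : ∀ m f → ∑± (suc m) f ≡ f (ℤ.- + suc m) + (∑± m f + f (+ suc m))
    ∑±-suc m f = trans (cong (window f (ℤ.- + suc m)) length≡)
      (trans (window-ends f (ℤ.- + suc m) (suc (2 * m)))
             (cong₂ (λ s t → f (ℤ.- + suc m) + (window f s (suc (2 * m)) + f t)) left right))
      where
      length≡ : suc (2 * suc m) ≡ suc (suc (2 * m) + 1)
      length≡ = cong suc (trans (*-suc 2 m) (cong suc (+-comm 1 (2 * m))))
      left : ℤ.- + suc m ℤ.+ + 1 ≡ ℤ.- + m
      left = trans (cong (λ t → ℤ.- t ℤ.+ + 1) (ℤP.pos-+ 1 m)) (lemma (+ m))
        where
        lemma : ∀ M → ℤ.- (+ 1 ℤ.+ M) ℤ.+ + 1 ≡ ℤ.- M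
        lemma = solve-∀
      right : ℤ.- + suc m ℤ.+ + 1 ℤ.+ + suc (2 * m) ≡ + suc m
      right = trans (cong₂ (λ t u → ℤ.- t ℤ.+ + 1 ℤ.+ u) (ℤP.pos-+ 1 m)
                           (trans (ℤP.pos-+ 1 (2 * m)) (cong (λ t → + 1 ℤ.+ t) (ℤP.pos-* 2 m))))
                    (trans (lemma (+ m)) (sym (ℤP.pos-+ 1 m)))
        where
        lemma : ∀ M → ℤ.- (+ 1 ℤ.+ M) ℤ.+ + 1 ℤ.+ (+ 1 ℤ.+ + 2 ℤ.* M) ≡ + 1 ℤ.+ M
        lemma = solve-∀

  within : ℕ → ℤ → ℕ
  within n k = 𝟙 (ℤ.∣ k ∣ ≤? n)

  ∑±-within : ∀ {n m} f → n ≤ m → ∑± m (λ k → within n k * f k) ≡ ∑± n f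
  ∑±-within {n} {m} f n≤m = subst (λ m → ∑± m f|n ≡ ∑± n f) (m∸n+n≡m n≤m) (beyond (m ∸ n))
    where
    f|n : ℤ → ℕ
    f|n k = within n k * f k

    kept : ∀ k → ℤ.∣ k ∣ ≤ n → f|n k ≡ f k
    kept k k≤n = trans (cong (_* f k) (𝟙-yes (ℤ.∣ k ∣ ≤? n) k≤n)) (+-identityʳ (f k))

    dropped : ∀ k → n < ℤ.∣ k ∣ → f|n k ≡ 0
    dropped k n<k = cong (_* f k) (𝟙-no (ℤ.∣ k ∣ ≤? n) (<⇒≱ n<k))

    inside : ∀ {l} → l ≤ n → ∑± l f|n ≡ ∑± l f
    inside {zero}  _   = trans (∑±-zero f|n) (trans (kept (+ 0) z≤n) (sym (∑±-zero f)))
    inside {suc l} l<n = trans (∑±-suc l f|n) (trans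
      (cong₂ (λ a b → a + (b + f|n (+ suc l))) (kept (ℤ.- + suc l) l<n) (inside (<⇒≤ l<n)))
      (trans (cong (λ c → f (ℤ.- + suc l) + (∑± l f + c)) (kept (+ suc l) l<n)) (sym (∑±-suc l f))))

    beyond : ∀ t → ∑± (t + n) f|n ≡ ∑± n f
    beyond zero    = inside ≤-refl
    beyond (suc t) = begin
      ∑± (suc t + n) f|n                                                  ≡⟨ ∑±-suc (t + n) f|n ⟩
      f|n (ℤ.- + suc (t + n)) + (∑± (t + n) f|n + f|n (+ suc (t + n)))   ≡⟨ cong₂ (λ a b → a + (∑± (t + n) f|n + b))
                                                                                  (dropped (ℤ.- + suc (t + n)) far) (dropped (+ suc (t + n)) far) ⟩
      ∑± (t + n) f|n + 0                                                  ≡⟨ +-identityʳ _ ⟩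
      ∑± (t + n) f|n                                                      ≡⟨ beyond t ⟩
      ∑± n f                                                              ∎
      where
      open ≡-Reasoning
      far : n < suc (t + n)
      far = s≤s (m≤n+m n t)

  ∑±⁴ : ℕ → (ℤ → ℤ → ℤ → ℤ → ℕ) → ℕ
  ∑±⁴ m F = ∑± m λ a → ∑± m λ b → ∑± m λ c → ∑± m λ d → F a b c d

  module ∑±⁴-Properties (m : ℕ) where
    open ∑±-Properties m
    private variable F G : ℤ → ℤ → ℤ → ℤ → ℕ

    ∑±⁴-cong : (∀ a b c d → F a b c d ≡ G a b c d) → ∑±⁴ m F ≡ ∑±⁴ m G
    ∑±⁴-cong F≗G = ∑±-cong λ a → ∑±-cong λ b → ∑±-cong λ c → ∑±-cong λ d → F≗G a b c d

    ∑±⁴-+ : ∑±⁴ m (λ a b c d → F a b c d + G a b c d) ≡ ∑±⁴ m F + ∑±⁴ m G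
    ∑±⁴-+ = trans (∑±-cong λ a → trans (∑±-cong λ b → trans (∑±-cong λ c → ∑±-+) ∑±-+) ∑±-+) ∑±-+

    ∑±⁴-1 : ∑±⁴ m (λ _ _ _ _ → 1) ≡ suc (2 * m) ^ 4
    ∑±⁴-1 = trans (∑±-cong λ _ → trans (∑±-cong λ _ → trans (∑±-cong λ _ → ∑±-const 1) (∑±-const _)) (∑±-const _)) (∑±-const _)

  ∑±⁴-within : ∀ {m n} G → m ≤ n →
    ∑±⁴ n (λ a b c d → within m a * (within m b * (within m c * (within m d * G a b c d)))) ≡ ∑±⁴ m G
  ∑±⁴-within {m} {n} G m≤n = begin
    ∑± n (λ a → ∑± n λ b → ∑± n λ c → ∑± n λ d → ⟦ a ⟧ * (⟦ b ⟧ * (⟦ c ⟧ * (⟦ d ⟧ * G a b c d))))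
      ≡⟨ ∑±-cong (λ a → ∑±-cong λ b → ∑±-cong λ c → trans (∑±-*ˡ ⟦ a ⟧) (cong (⟦ a ⟧ *_)
           (trans (∑±-*ˡ ⟦ b ⟧) (cong (⟦ b ⟧ *_) (trans (∑±-*ˡ ⟦ c ⟧) (cong (⟦ c ⟧ *_) (∑±-within (G a b c) m≤n))))))) ⟩
    ∑± n (λ a → ∑± n λ b → ∑± n λ c → ⟦ a ⟧ * (⟦ b ⟧ * (⟦ c ⟧ * ∑± m (G a b c))))
      ≡⟨ ∑±-cong (λ a → ∑±-cong λ b → trans (∑±-*ˡ ⟦ a ⟧) (cong (⟦ a ⟧ *_)
           (trans (∑±-*ˡ ⟦ b ⟧) (cong (⟦ b ⟧ *_) (∑±-within (λ c → ∑± m (G a b c)) m≤n))))) ⟩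
    ∑± n (λ a → ∑± n λ b → ⟦ a ⟧ * (⟦ b ⟧ * ∑± m (λ c → ∑± m (G a b c))))
      ≡⟨ ∑±-cong (λ a → trans (∑±-*ˡ ⟦ a ⟧) (cong (⟦ a ⟧ *_) (∑±-within (λ b → ∑± m λ c → ∑± m (G a b c)) m≤n))) ⟩
    ∑± n (λ a → ⟦ a ⟧ * ∑± m (λ b → ∑± m λ c → ∑± m (G a b c)))
      ≡⟨ ∑±-within (λ a → ∑± m λ b → ∑± m λ c → ∑± m (G a b c)) m≤n ⟩
    ∑±⁴ m G ∎
    where
    open ≡-Reasoning
    open ∑±-Properties n
    ⟦_⟧ : ℤ → ℕ
    ⟦_⟧ = within m

open Sums

module Congruences where
  open import Data.Nat.Base as ℕ using (ℕ; _<_; ∣_-_∣; NonZero)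
  open import Data.Nat.Properties using (≤-<-trans; ∣m-n∣≤m⊔n; ⊔-lub; ∣m-n∣≡0⇒m≡n)
  open import Data.Nat.Divisibility using (_∣_; _∣?_; n∣m⇒m%n≡0)
  open import Data.Nat.DivMod using (m<n⇒m%n≡m)
  open import Data.Nat.Primality using (Prime; prime⇒irreducible; prime⇒nonZero; euclidsLemma)
  open import Data.Nat.Coprimality using (Coprime; coprime-Bézout)
  open import Data.Nat.GCD using (module Bézout)
  open import Data.Integer as ℤ using (ℤ; +_)
  open import Data.Integer.DivMod using (_%ℕ_; _/ℕ_; n%ℕd<d; a≡a%ℕn+[a/ℕn]*n)
  import Data.Integer.Properties as ℤP
  open import Data.Integer.Divisibility.Signed as ℤ∣ using (divides; ∣ᵤ⇒∣; ∣⇒∣ᵤ)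
  open import Data.Integer.Tactic.RingSolver using (solve-∀)
  open import Data.Product using (∃; _,_; proj₁; proj₂)
  open import Data.Sum using (inj₁; inj₂)
  open import Relation.Nullary using (¬_)
  open import Relation.Nullary.Negation using (contradiction)
  open import Relation.Binary.PropositionalEquality

  pos-+*-cong : ∀ a b c d e → a ℕ.+ b ℕ.* c ≡ d ℕ.* e → + a ℤ.+ + b ℤ.* + c ≡ + d ℤ.* + e
  pos-+*-cong a b c d e eq = begin
    + a ℤ.+ + b ℤ.* + c   ≡⟨ cong (λ t → + a ℤ.+ t) (ℤP.pos-* b c) ⟨
    + a ℤ.+ + (b ℕ.* c)   ≡⟨ ℤP.pos-+ a (b ℕ.* c) ⟨
    + (a ℕ.+ b ℕ.* c)     ≡⟨ cong +_ eq ⟩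
    + (d ℕ.* e)           ≡⟨ ℤP.pos-* d e ⟩
    + d ℤ.* + e           ∎
    where open ≡-Reasoning

  module _ {p : ℕ} (prime : Prime p) where
    private instance
      p≢0 : NonZero p
      p≢0 = prime⇒nonZero prime

    ∤⇒coprime : ∀ {n} → ¬ p ∣ n → Coprime n p
    ∤⇒coprime p∤n {d} (d∣n , d∣p) with prime⇒irreducible prime d∣p
    ... | inj₁ d≡1 = d≡1
    ... | inj₂ refl = contradiction d∣n p∤n

    multiple<⇒0 : ∀ {n} → p ∣ n → n < p → n ≡ 0
    multiple<⇒0 {n} p∣n n<p = trans (sym (m<n⇒m%n≡m n<p)) (n∣m⇒m%n≡0 n p p∣n)

    -- Bézout for ∣ u ∣ and p gives the inverse up to the sign of u.
    inverse : ∀ {u} → ¬ p ∣ ℤ.∣ u ∣ → ∃ λ c → (+ p) ℤ∣.∣ u ℤ.* c ℤ.- + 1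
    inverse {u} p∤u with ℤP.+∣i∣≡i⊎+∣i∣≡-i u | inverse-abs
      where
      inverse-abs : ∃ λ c → (+ p) ℤ∣.∣ + ℤ.∣ u ∣ ℤ.* c ℤ.- + 1
      inverse-abs with coprime-Bézout (∤⇒coprime p∤u)
      ... | Bézout.+- x y eq = + x , divides (+ y) (begin
        U ℤ.* + x ℤ.- + 1                ≡⟨ cong (ℤ._- + 1) (ℤP.*-comm U (+ x)) ⟩
        + x ℤ.* U ℤ.- + 1                ≡⟨ cong (ℤ._- + 1) (sym (pos-+*-cong 1 y p x ℤ.∣ u ∣ eq)) ⟩
        + 1 ℤ.+ + y ℤ.* + p ℤ.- + 1      ≡⟨ lemma (+ y ℤ.* + p) ⟩
        + y ℤ.* + p                      ∎)
        where
        open ≡-Reasoning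
        U = + ℤ.∣ u ∣
        lemma : ∀ A → + 1 ℤ.+ A ℤ.- + 1 ≡ A
        lemma = solve-∀
      ... | Bézout.-+ x y eq = ℤ.- + x , divides (ℤ.- + y) (begin
        U ℤ.* ℤ.- + x ℤ.- + 1            ≡⟨ lemma U (+ x) ⟩
        ℤ.- (+ 1 ℤ.+ + x ℤ.* U)          ≡⟨ cong ℤ.-_ (pos-+*-cong 1 x ℤ.∣ u ∣ y p eq) ⟩
        ℤ.- (+ y ℤ.* + p)                ≡⟨ ℤP.neg-distribˡ-* (+ y) (+ p) ⟩
        ℤ.- + y ℤ.* + p                  ∎)
        where
        open ≡-Reasoning
        U = + ℤ.∣ u ∣
        lemma : ∀ U X → U ℤ.* ℤ.- X ℤ.- + 1 ≡ ℤ.- (+ 1 ℤ.+ X ℤ.* U)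
        lemma = solve-∀
    ... | inj₁ ∣u∣≡u  | c , div = c , subst (λ w → (+ p) ℤ∣.∣ w ℤ.* c ℤ.- + 1) ∣u∣≡u div
    ... | inj₂ ∣u∣≡-u | c , div = ℤ.- c , subst ((+ p) ℤ∣.∣_) (sign-flip ∣u∣≡-u) div
      where
      sign-flip : + ℤ.∣ u ∣ ≡ ℤ.- u → + ℤ.∣ u ∣ ℤ.* c ℤ.- + 1 ≡ u ℤ.* ℤ.- c ℤ.- + 1
      sign-flip e = trans (cong (λ w → w ℤ.* c ℤ.- + 1) e) (lemma u c)
        where
        lemma : ∀ u c → ℤ.- u ℤ.* c ℤ.- + 1 ≡ u ℤ.* ℤ.- c ℤ.- + 1
        lemma = solve-∀

    module _ {u : ℤ} (p∤u : ¬ p ∣ ℤ.∣ u ∣) (v : ℤ) where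
      Root : ℤ → Set
      Root k = (+ p) ℤ∣.∣ u ℤ.* k ℤ.+ v

      root : ∃ Root
      root with inverse {u} p∤u
      ... | c , uc≡1 = c ℤ.* ℤ.- v , subst ((+ p) ℤ∣.∣_) (lemma u c v) (ℤ∣.∣m⇒∣m*n (ℤ.- v) uc≡1)
        where
        lemma : ∀ u c v → (u ℤ.* c ℤ.- + 1) ℤ.* ℤ.- v ≡ u ℤ.* (c ℤ.* ℤ.- v) ℤ.+ v
        lemma = solve-∀

      root-shift : ∀ {k} t → Root k → Root (k ℤ.+ t ℤ.* + p)
      root-shift {k} t rk = subst ((+ p) ℤ∣.∣_) (lemma u k t (+ p) v) (ℤ∣.∣m∣n⇒∣m+n rk (ℤ∣.∣n⇒∣m*n (u ℤ.* t) ℤ∣.∣-refl))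
        where
        lemma : ∀ u k t P v → u ℤ.* k ℤ.+ v ℤ.+ u ℤ.* t ℤ.* P ≡ u ℤ.* (k ℤ.+ t ℤ.* P) ℤ.+ v
        lemma = solve-∀

      roots-congruent : ∀ {k k′} → Root k → Root k′ → p ∣ ℤ.∣ k ℤ.- k′ ∣
      roots-congruent {k} {k′} rk rk′ with euclidsLemma ℤ.∣ u ∣ ℤ.∣ k ℤ.- k′ ∣ prime p∣u[k-k′]
        where
        p∣u[k-k′] : p ∣ ℤ.∣ u ∣ ℕ.* ℤ.∣ k ℤ.- k′ ∣
        p∣u[k-k′] = subst (p ∣_) (ℤP.abs-* u (k ℤ.- k′))
                      (∣⇒∣ᵤ (subst ((+ p) ℤ∣.∣_) (lemma u k k′ v) (ℤ∣.∣m∣n⇒∣m-n rk rk′)))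
          where
          lemma : ∀ u k k′ v → u ℤ.* k ℤ.+ v ℤ.- (u ℤ.* k′ ℤ.+ v) ≡ u ℤ.* (k ℤ.- k′)
          lemma = solve-∀
      ... | inj₁ p∣u = contradiction p∣u p∤u
      ... | inj₂ p∣k-k′ = p∣k-k′

      -- The root in the window is s + ((k₀ - s) mod p); two roots in it differ by less than p.
      roots-in-window : ∀ s → window (λ k → 𝟙 (p ∣? ℤ.∣ u ℤ.* k ℤ.+ v ∣)) s p ≡ 1
      roots-in-window s = ∑<-single p (n%ℕd<d (k₀ ℤ.- s) p)
        (𝟙-yes (p ∣? _) (∣⇒∣ᵤ root-in-window))
        (λ j j<p j≢i₀ → 𝟙-no (p ∣? _) (λ rj → j≢i₀ (unique j<p (n%ℕd<d (k₀ ℤ.- s) p) (∣ᵤ⇒∣ rj) root-in-window)))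
        where
        k₀ = proj₁ root
        i₀ = (k₀ ℤ.- s) %ℕ p
        q₀ = (k₀ ℤ.- s) /ℕ p

        root-in-window : Root (s ℤ.+ + i₀)
        root-in-window = subst Root shift (root-shift {k₀} (ℤ.- q₀) (proj₂ root))
          where
          shift : k₀ ℤ.+ ℤ.- q₀ ℤ.* + p ≡ s ℤ.+ + i₀
          shift = begin
            k₀ ℤ.+ ℤ.- q₀ ℤ.* + p                              ≡⟨ lemma₁ k₀ s q₀ (+ p) ⟩
            s ℤ.+ ((k₀ ℤ.- s) ℤ.- q₀ ℤ.* + p)                   ≡⟨ cong (λ t → s ℤ.+ (t ℤ.- q₀ ℤ.* + p)) (a≡a%ℕn+[a/ℕn]*n (k₀ ℤ.- s) p) ⟩
            s ℤ.+ (+ i₀ ℤ.+ q₀ ℤ.* + p ℤ.- q₀ ℤ.* + p)          ≡⟨ lemma₂ s (+ i₀) (q₀ ℤ.* + p) ⟩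
            s ℤ.+ + i₀                                         ∎
            where
            open ≡-Reasoning
            lemma₁ : ∀ k s Q P → k ℤ.+ ℤ.- Q ℤ.* P ≡ s ℤ.+ ((k ℤ.- s) ℤ.- Q ℤ.* P)
            lemma₁ = solve-∀
            lemma₂ : ∀ s i A → s ℤ.+ (i ℤ.+ A ℤ.- A) ≡ s ℤ.+ i
            lemma₂ = solve-∀

        unique : ∀ {i j} → i < p → j < p → Root (s ℤ.+ + i) → Root (s ℤ.+ + j) → i ≡ j
        unique {i} {j} i<p j<p ri rj = ∣m-n∣≡0⇒m≡n (multiple<⇒0 p∣i-j (≤-<-trans (∣m-n∣≤m⊔n i j) (⊔-lub i<p j<p)))
          where
          p∣i-j : p ∣ ∣ i - j ∣
          p∣i-j = subst (p ∣_) (trans (cong ℤ.∣_∣ (lemma s (+ i) (+ j))) (sym (∣-∣≡∣+-+∣ i j))) (roots-congruent ri rj)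
            where
            lemma : ∀ s i j → s ℤ.+ i ℤ.- (s ℤ.+ j) ≡ i ℤ.- j
            lemma = solve-∀

open Congruences

module SingularMatrices where
  open import Data.Nat.Base using (ℕ; suc; _+_; _*_; _^_; _≤_; z≤n; ∣_-_∣; NonZero)
  open import Data.Nat.Properties
  open import Data.Nat.Divisibility using (_∣_; _∣?_; ∣1⇒≡1)
  open import Data.Nat.Primality using (Prime; ¬prime[1]; euclidsLemma)
  open import Data.Nat.Tactic.RingSolver using (solve-∀)
  open import Data.Integer as ℤ using (ℤ; +_)
  import Data.Integer.Properties as ℤP
  open import Data.Integer.Tactic.RingSolver renaming (solve-∀ to ℤ-solve-∀)
  open import Data.Integer.Divisibility.Signed as ℤ∣ using (∣ᵤ⇒∣; ∣⇒∣ᵤ)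
  open import Data.Sum using (inj₁; inj₂)
  open import Function using (_⇔_; mk⇔)
  open import Relation.Nullary using (Dec; ¬_; ¬?; yes; no)
  open import Relation.Nullary.Negation using (contradiction)
  open import Relation.Binary.PropositionalEquality

  nonsingular : ℕ → ℕ → ℕ
  nonsingular p m = ∑±⁴ m λ a b c d → 𝟙 (¬? (p ∣? ℤ.∣ a ℤ.* d ℤ.- b ℤ.* c ∣))

  module SingularCount {q : ℕ} (prime : Prime (suc q)) (m : ℕ) where
    open ∑±-Properties m
    open ∑±⁴-Properties m

    p N : ℕ
    p = suc q
    N = suc (2 * m)

    𝟙∣ : ℤ → ℕ
    𝟙∣ k = 𝟙 (p ∣? ℤ.∣ k ∣)

    linear-count : ∀ {u} → ¬ p ∣ ℤ.∣ u ∣ → ∀ v → ∣ p * ∑± m (λ k → 𝟙∣ (u ℤ.* k ℤ.+ v)) - N ∣ ≤ p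
    linear-count {u} p∤u v = subst (λ w → ∣ p * w - N ∣ ≤ p) (sym (∑±≡window m roots))
      (window-count roots (roots-in-window prime {u} p∤u v) (ℤ.- + m) N)
      where
      roots : ℤ → ℕ
      roots k = 𝟙∣ (u ℤ.* k ℤ.+ v)

    zeros : ℕ
    zeros = ∑± m 𝟙∣

    zeros-count : ∣ p * zeros - N ∣ ≤ p
    zeros-count = subst (λ w → ∣ p * w - N ∣ ≤ p) (∑±-cong λ k → cong 𝟙∣ (trans (ℤP.+-identityʳ _) (ℤP.*-identityˡ k)))
      (linear-count {+ 1} p∤1 (+ 0))
      where
      p∤1 : ¬ p ∣ 1
      p∤1 p∣1 = ¬prime[1] (subst Prime (∣1⇒≡1 p∣1) prime)

    pairs : ℤ → ℤ → ℕ
    pairs a b = ∑± m λ c → ∑± m λ d → 𝟙∣ (a ℤ.* d ℤ.- b ℤ.* c)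

    expected : ℤ → ℤ → ℕ
    expected a b = N * N + q * (N * N) * (𝟙∣ a * 𝟙∣ b)

    private
      𝟙∣-yes : ∀ k → p ∣ ℤ.∣ k ∣ → 𝟙∣ k ≡ 1
      𝟙∣-yes k = 𝟙-yes (p ∣? ℤ.∣ k ∣)

      𝟙∣-no : ∀ k → ¬ p ∣ ℤ.∣ k ∣ → 𝟙∣ k ≡ 0
      𝟙∣-no k = 𝟙-no (p ∣? ℤ.∣ k ∣)

      signed : ∀ k → p ∣ ℤ.∣ k ∣ → (+ p) ℤ∣.∣ k
      signed k = ∣ᵤ⇒∣ {+ p} {k}

      ∣a∧∣b⇒∣det : ∀ a b c d → p ∣ ℤ.∣ a ∣ → p ∣ ℤ.∣ b ∣ → p ∣ ℤ.∣ a ℤ.* d ℤ.- b ℤ.* c ∣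
      ∣a∧∣b⇒∣det a b c d p∣a p∣b = ∣⇒∣ᵤ (ℤ∣.∣m∣n⇒∣m-n (ℤ∣.∣m⇒∣m*n d (signed a p∣a)) (ℤ∣.∣m⇒∣m*n c (signed b p∣b)))

      ∣det⇔∣c : ∀ a b c d → p ∣ ℤ.∣ a ∣ → ¬ p ∣ ℤ.∣ b ∣ → p ∣ ℤ.∣ a ℤ.* d ℤ.- b ℤ.* c ∣ ⇔ p ∣ ℤ.∣ c ∣
      ∣det⇔∣c a b c d p∣a p∤b = mk⇔ to from
        where
        to : p ∣ ℤ.∣ a ℤ.* d ℤ.- b ℤ.* c ∣ → p ∣ ℤ.∣ c ∣
        to p∣det with euclidsLemma ℤ.∣ b ∣ ℤ.∣ c ∣ prime (subst (p ∣_) (ℤP.abs-* b c) (∣⇒∣ᵤ p∣bc))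
          where
          p∣bc : (+ p) ℤ∣.∣ b ℤ.* c
          p∣bc = subst ((+ p) ℤ∣.∣_) (lemma (a ℤ.* d) (b ℤ.* c))
                   (ℤ∣.∣m∣n⇒∣m-n (ℤ∣.∣m⇒∣m*n d (signed a p∣a)) (signed (a ℤ.* d ℤ.- b ℤ.* c) p∣det))
            where
            lemma : ∀ x y → x ℤ.- (x ℤ.- y) ≡ y
            lemma = ℤ-solve-∀
        ... | inj₁ p∣b = contradiction p∣b p∤b
        ... | inj₂ p∣c = p∣c
        from : p ∣ ℤ.∣ c ∣ → p ∣ ℤ.∣ a ℤ.* d ℤ.- b ℤ.* c ∣
        from p∣c = ∣⇒∣ᵤ (ℤ∣.∣m∣n⇒∣m-n (ℤ∣.∣m⇒∣m*n d (signed a p∣a)) (ℤ∣.∣n⇒∣m*n b (signed c p∣c)))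

    private
      expected-N² : ∀ a b → 𝟙∣ a * 𝟙∣ b ≡ 0 → expected a b ≡ N * N
      expected-N² a b e = trans (cong (λ t → N * N + q * (N * N) * t) e)
                                (trans (cong (λ t → N * N + t) (*-zeroʳ (q * (N * N)))) (+-identityʳ (N * N)))

    -- If p ∤ a, the condition p ∣ ad - bc is a linear congruence in d; if p ∣ a and p ∤ b it
    -- says p ∣ c; if p divides both a and b it always holds.
    pairs-count : ∀ a b → ∣ p * pairs a b - expected a b ∣ ≤ N * p
    pairs-count a b = by-cases (p ∣? ℤ.∣ a ∣) (p ∣? ℤ.∣ b ∣)
      where
      by-cases : Dec (p ∣ ℤ.∣ a ∣) → Dec (p ∣ ℤ.∣ b ∣) → ∣ p * pairs a b - expected a b ∣ ≤ N * p
      by-cases (no p∤a) _ = begin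
        ∣ p * pairs a b - expected a b ∣                                  ≡⟨ cong₂ ∣_-_∣ (sym (∑±-*ˡ p)) expected≡ ⟩
        ∣ ∑± m (λ c → p * ∑± m λ d → 𝟙∣ (a ℤ.* d ℤ.- b ℤ.* c)) - ∑± m (λ _ → N) ∣
                                                                          ≤⟨ ∑±-dist (λ c → linear-count {a} p∤a (ℤ.- (b ℤ.* c))) ⟩
        N * p                                                             ∎
        where
        open ≤-Reasoning
        expected≡ = trans (expected-N² a b (cong (_* 𝟙∣ b) (𝟙∣-no a p∤a))) (sym (∑±-const N))
      by-cases (yes p∣a) (no p∤b) = begin
        ∣ p * pairs a b - expected a b ∣         ≡⟨ cong₂ (λ s t → ∣ p * s - t ∣) pairs≡ expected≡ ⟩
        ∣ p * (N * zeros) - N * N ∣              ≡⟨ cong (λ t → ∣ t - N * N ∣) (*-comm-assoc p N zeros) ⟩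
        ∣ N * (p * zeros) - N * N ∣              ≡⟨ *-distribˡ-∣-∣ N (p * zeros) N ⟨
        N * ∣ p * zeros - N ∣                    ≤⟨ *-monoʳ-≤ N zeros-count ⟩
        N * p                                    ∎
        where
        open ≤-Reasoning
        *-comm-assoc : ∀ x y z → x * (y * z) ≡ y * (x * z)
        *-comm-assoc = solve-∀
        pairs≡ : pairs a b ≡ N * zeros
        pairs≡ = trans (∑±-cong λ c → trans (∑±-cong λ d → 𝟙-cong (p ∣? _) (p ∣? _) (∣det⇔∣c a b c d p∣a p∤b))
                                            (∑±-const (𝟙∣ c)))
                       (∑±-*ˡ N)
        expected≡ = expected-N² a b (trans (cong (𝟙∣ a *_) (𝟙∣-no b p∤b)) (*-zeroʳ (𝟙∣ a)))
      by-cases (yes p∣a) (yes p∣b) = ≤-trans (≤-reflexive (trans (cong₂ ∣_-_∣ pairs≡ expected≡) (∣n-n∣≡0 (p * (N * (N * 1)))))) z≤n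
        where
        pairs≡ : p * pairs a b ≡ p * (N * (N * 1))
        pairs≡ = cong (p *_) (trans (∑±-cong λ c → trans (∑±-cong λ d → 𝟙∣-yes (a ℤ.* d ℤ.- b ℤ.* c) (∣a∧∣b⇒∣det a b c d p∣a p∣b))
                                                         (∑±-const 1))
                                    (∑±-const (N * 1)))
        expected≡ : expected a b ≡ p * (N * (N * 1))
        expected≡ = trans (cong₂ (λ s t → N * N + q * (N * N) * (s * t)) (𝟙∣-yes a p∣a) (𝟙∣-yes b p∣b)) (lemma q N)
          where
          lemma : ∀ q N → N * N + q * (N * N) * (1 * 1) ≡ (1 + q) * (N * (N * 1))
          lemma = solve-∀

    expected-total : ∑± m (λ a → ∑± m λ b → expected a b) ≡ N ^ 4 + q * N ^ 2 * zeros ^ 2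
    expected-total = begin
      ∑± m (λ a → ∑± m λ b → N * N + c * (𝟙∣ a * 𝟙∣ b))              ≡⟨ ∑±-cong (λ a → inner a) ⟩
      ∑± m (λ a → N * (N * N) + c * (𝟙∣ a * zeros))                 ≡⟨ ∑±-+ ⟩
      ∑± m (λ _ → N * (N * N)) + ∑± m (λ a → c * (𝟙∣ a * zeros))    ≡⟨ cong₂ _+_ (∑±-const (N * (N * N))) outer ⟩
      N * (N * (N * N)) + c * (zeros * zeros)                       ≡⟨ lemma q N zeros ⟩
      N ^ 4 + q * N ^ 2 * zeros ^ 2                                 ∎
      where
      open ≡-Reasoning
      c = q * (N * N)
      inner : ∀ a → ∑± m (λ b → N * N + c * (𝟙∣ a * 𝟙∣ b)) ≡ N * (N * N) + c * (𝟙∣ a * zeros)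
      inner a = trans ∑±-+ (cong₂ _+_ (∑±-const (N * N)) (trans (∑±-*ˡ c) (cong (c *_) (∑±-*ˡ (𝟙∣ a)))))
      outer : ∑± m (λ a → c * (𝟙∣ a * zeros)) ≡ c * (zeros * zeros)
      outer = trans (∑±-cong λ a → cong (c *_) (*-comm (𝟙∣ a) zeros)) (trans (∑±-*ˡ c) (cong (c *_) (∑±-*ˡ zeros)))
      lemma : ∀ q N z → N * (N * (N * N)) + q * (N * N) * (z * z) ≡ N * (N * (N * (N * 1))) + q * (N * (N * 1)) * (z * (z * 1))
      lemma = solve-∀

    singular : ℕ
    singular = ∑±⁴ m λ a b c d → 𝟙∣ (a ℤ.* d ℤ.- b ℤ.* c)

    singular-count : ∣ p * singular - (N ^ 4 + q * N ^ 2 * zeros ^ 2) ∣ ≤ p * N ^ 3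
    singular-count = begin
      ∣ p * singular - (N ^ 4 + q * N ^ 2 * zeros ^ 2) ∣
        ≡⟨ cong₂ ∣_-_∣ (trans (sym (∑±-*ˡ p)) (∑±-cong λ a → sym (∑±-*ˡ p))) (sym expected-total) ⟩
      ∣ ∑± m (λ a → ∑± m λ b → p * pairs a b) - ∑± m (λ a → ∑± m λ b → expected a b) ∣
        ≤⟨ ∑±-dist (λ a → ∑±-dist (λ b → pairs-count a b)) ⟩
      N * (N * (N * p))
        ≡⟨ lemma p N ⟩
      p * N ^ 3 ∎
      where
      open ≤-Reasoning
      lemma : ∀ p N → N * (N * (N * p)) ≡ p * (N * (N * (N * 1)))
      lemma = solve-∀

    nonsingular+singular : nonsingular p m + singular ≡ N ^ 4
    nonsingular+singular = trans (sym ∑±⁴-+) (trans (∑±⁴-cong λ a b c d → 𝟙-¬ (p ∣? ℤ.∣ a ℤ.* d ℤ.- b ℤ.* c ∣)) ∑±⁴-1)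

  -- q²(q + 2) = p³ γ_p for p = q + 1.
  p³-split : ∀ q → suc q ^ 3 ≡ q ^ 2 * (q + 2) + (suc q ^ 2 + q)
  p³-split q = lemma q
    where
    lemma : ∀ q → (1 + q) * ((1 + q) * ((1 + q) * 1)) ≡ q * (q * 1) * (q + 2) + ((1 + q) * ((1 + q) * 1) + q)
    lemma = solve-∀

  square-defect : ∀ p q N z →
    ∣ (p ^ 2 + q) * N ^ 4 - p ^ 2 * (N ^ 4 + q * N ^ 2 * z ^ 2) ∣ ≡ q * N ^ 2 * (∣ N - p * z ∣ * (N + p * z))
  square-defect p q N z = begin
    ∣ (p ^ 2 + q) * N ^ 4 - p ^ 2 * (N ^ 4 + q * N ^ 2 * z ^ 2) ∣
      ≡⟨ cong₂ ∣_-_∣ (lemma₁ p q N) (lemma₂ p q N z) ⟩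
    ∣ p ^ 2 * N ^ 4 + q * N ^ 4 - p ^ 2 * N ^ 4 + q * N ^ 2 * (p * z * (p * z)) ∣
      ≡⟨ ∣m+n-m+o∣≡∣n-o∣ (p ^ 2 * N ^ 4) _ _ ⟩
    ∣ q * N ^ 4 - q * N ^ 2 * (p * z * (p * z)) ∣
      ≡⟨ cong (λ t → ∣ t - q * N ^ 2 * (p * z * (p * z)) ∣) (lemma₃ q N) ⟩
    ∣ q * N ^ 2 * (N * N) - q * N ^ 2 * (p * z * (p * z)) ∣
      ≡⟨ *-distribˡ-∣-∣ (q * N ^ 2) (N * N) (p * z * (p * z)) ⟨
    q * N ^ 2 * ∣ N * N - p * z * (p * z) ∣
      ≡⟨ cong (q * N ^ 2 *_) (∣m*m-n*n∣≡∣m-n∣*[m+n] N (p * z)) ⟩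
    q * N ^ 2 * (∣ N - p * z ∣ * (N + p * z)) ∎
    where
    open ≡-Reasoning
    lemma₁ : ∀ p q N → (p * (p * 1) + q) * (N * (N * (N * (N * 1))))
                     ≡ p * (p * 1) * (N * (N * (N * (N * 1)))) + q * (N * (N * (N * (N * 1))))
    lemma₁ = solve-∀
    lemma₂ : ∀ p q N z → p * (p * 1) * (N * (N * (N * (N * 1))) + q * (N * (N * 1)) * (z * (z * 1)))
                       ≡ p * (p * 1) * (N * (N * (N * (N * 1)))) + q * (N * (N * 1)) * (p * z * (p * z))
    lemma₂ = solve-∀
    lemma₃ : ∀ q N → q * (N * (N * (N * (N * 1)))) ≡ q * (N * (N * 1)) * (N * N)
    lemma₃ = solve-∀

  nonsingular-estimate : ∀ q {N z S T} .{{_ : NonZero N}} → let p = suc q in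
    ∣ p * z - N ∣ ≤ p → ∣ p * S - (N ^ 4 + q * N ^ 2 * z ^ 2) ∣ ≤ p * N ^ 3 → T + S ≡ N ^ 4 →
    ∣ p ^ 3 * T - q ^ 2 * (q + 2) * N ^ 4 ∣ ≤ 4 * p ^ 3 * N ^ 3
  nonsingular-estimate q {N} {z} {S} {T} zeros≈ S≈ T+S≡N⁴ = begin
    ∣ p ^ 3 * T - γ′ * N ^ 4 ∣                               ≡⟨ ∣-∣-transfer {p ^ 3 * T} {p ^ 3 * S} {γ′ * N ^ 4} {(p ^ 2 + q) * N ^ 4} total ⟩
    ∣ (p ^ 2 + q) * N ^ 4 - p ^ 3 * S ∣                      ≤⟨ ∣-∣-triangle ((p ^ 2 + q) * N ^ 4) (p ^ 2 * E) (p ^ 3 * S) ⟩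
    ∣ (p ^ 2 + q) * N ^ 4 - p ^ 2 * E ∣ + ∣ p ^ 2 * E - p ^ 3 * S ∣
        ≡⟨ cong₂ _+_ (square-defect p q N z) error-term ⟩
    q * N ^ 2 * (∣ N - p * z ∣ * (N + p * z)) + p ^ 2 * ∣ E - p * S ∣
        ≤⟨ +-mono-≤ (*-monoʳ-≤ (q * N ^ 2) (*-mono-≤ (≤-trans (≤-reflexive (∣-∣-comm N (p * z))) zeros≈) pz-bound))
                    (*-monoʳ-≤ (p ^ 2) (≤-trans (≤-reflexive (∣-∣-comm E (p * S))) S≈)) ⟩
    q * N ^ 2 * (p * (N + (N + p))) + p ^ 2 * (p * N ^ 3)
        ≤⟨ +-monoˡ-≤ _ (*-mono-≤ (*-monoˡ-≤ (N ^ 2) (n≤1+n q)) (*-monoʳ-≤ p N+N+p≤3pN)) ⟩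
    p * N ^ 2 * (p * (p * N + (p * N + p * N))) + p ^ 2 * (p * N ^ 3)
        ≡⟨ lemma p N ⟩
    4 * p ^ 3 * N ^ 3                                        ∎
    where
    open ≤-Reasoning
    p = suc q
    γ′ = q ^ 2 * (q + 2)
    E = N ^ 4 + q * N ^ 2 * z ^ 2
    total : p ^ 3 * T + p ^ 3 * S ≡ γ′ * N ^ 4 + (p ^ 2 + q) * N ^ 4
    total = trans (sym (*-distribˡ-+ (p ^ 3) T S))
              (trans (cong₂ _*_ (p³-split q) T+S≡N⁴) (*-distribʳ-+ (N ^ 4) γ′ (p ^ 2 + q)))
    error-term : ∣ p ^ 2 * E - p ^ 3 * S ∣ ≡ p ^ 2 * ∣ E - p * S ∣
    error-term = trans (cong (λ t → ∣ p ^ 2 * E - t ∣) (lemma p S)) (sym (*-distribˡ-∣-∣ (p ^ 2) E (p * S)))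
      where
      lemma : ∀ p S → p * (p * (p * 1)) * S ≡ p * (p * 1) * (p * S)
      lemma = solve-∀
    pz-bound : N + p * z ≤ N + (N + p)
    pz-bound = +-monoʳ-≤ N (≤-trans (m≤n+∣m-n∣ (p * z) N) (+-monoʳ-≤ N zeros≈))
    N+N+p≤3pN : N + (N + p) ≤ p * N + (p * N + p * N)
    N+N+p≤3pN = +-mono-≤ (m≤n*m N p) (+-mono-≤ (m≤n*m N p) (m≤m*n p N))
    lemma : ∀ p N → p * (N * (N * 1)) * (p * (p * N + (p * N + p * N))) + p * (p * 1) * (p * (N * (N * (N * 1))))
                    ≡ 4 * (p * (p * (p * 1))) * (N * (N * (N * 1)))
    lemma = solve-∀

open SingularMatrices

module Rationals where
  open import Data.Nat.Base as ℕ using (ℕ; zero; suc; _/_)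
  import Data.Nat.Properties as ℕP
  open import Data.Nat.Coprimality using (1-coprimeTo) renaming (sym to coprime-sym)
  open import Data.Nat.DivMod using (m/n*n≤m; m%n<n; m≡m%n+[m/n]*n)
  open import Data.Integer as ℤ using (ℤ; +_; +0; +[1+_]; -[1+_])
  import Data.Integer.Properties as ℤP
  open import Data.Integer.DivMod using (_/ℕ_; div-pos-is-/ℕ; [n/ℕd]*d≤n)
  open import Data.Rational as ℚ using (ℚ; mkℚ; 0ℚ; 1ℚ; _≤_; _<_; _+_; _-_; _*_; *≤*; *<*; ∣_∣; ceiling; nonNegative)
  import Data.Rational.Properties as ℚP
  open import Data.Rational.Properties using (normalize-coprime)
  open import Data.Maybe using (Maybe)
  open import Data.Empty using (⊥-elim)
  open import Data.Product using (∃; _×_; _,_)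
  open import Data.Sum using (inj₁; inj₂)
  open import Level using (0ℓ)
  open import Relation.Nullary using (¬_)
  open import Relation.Nullary.Decidable using (dec⇒maybe)
  open import Relation.Binary.PropositionalEquality
  open import Tactic.RingSolver using (solve-∀)
  open import Tactic.RingSolver.Core.AlmostCommutativeRing using (AlmostCommutativeRing; fromCommutativeRing)

  ℚ-ring : AlmostCommutativeRing 0ℓ 0ℓ
  ℚ-ring = fromCommutativeRing ℚP.+-*-commutativeRing zero?
    where
    zero? : ∀ x → Maybe (0ℚ ≡ x)
    zero? x = dec⇒maybe (0ℚ ℚP.≟ x)

  ι : ℕ → ℚ
  ι k = + k ℚ./ 1

  ι-mkℚ : ∀ k → ι k ≡ mkℚ (+ k) 0 (coprime-sym (1-coprimeTo k))
  ι-mkℚ k = normalize-coprime (coprime-sym (1-coprimeTo k))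

  ι-+ : ∀ a b → ι (a ℕ.+ b) ≡ ι a + ι b
  ι-+ a b rewrite ι-mkℚ a | ι-mkℚ b =
    cong (ℚ._/ 1) (trans (ℤP.pos-+ a b) (sym (cong₂ ℤ._+_ (ℤP.*-identityʳ (+ a)) (ℤP.*-identityʳ (+ b)))))

  ι-* : ∀ a b → ι (a ℕ.* b) ≡ ι a * ι b
  ι-* a b rewrite ι-mkℚ a | ι-mkℚ b = cong (ℚ._/ 1) (ℤP.pos-* a b)

  ι-^ : ∀ a n → ι (a ℕ.^ n) ≡ ι a ^ℚ n
  ι-^ a zero    = refl
  ι-^ a (suc n) = trans (ι-* a (a ℕ.^ n)) (cong (ι a *_) (ι-^ a n))

  ι-mono-≤ : ∀ {a b} → a ℕ.≤ b → ι a ≤ ι b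
  ι-mono-≤ {a} {b} a≤b rewrite ι-mkℚ a | ι-mkℚ b =
    *≤* (ℤP.*-monoʳ-≤-nonNeg (+ 1) (ℤ.+≤+ a≤b))

  ι-pos : ∀ n .{{_ : ℕ.NonZero n}} → 0ℚ < ι n
  ι-pos (suc k) rewrite ι-mkℚ (suc k) = ℚP.positive⁻¹ _

  inv-ι : ∀ n .{{_ : ℕ.NonZero n}} → inv n * ι n ≡ 1ℚ
  inv-ι (suc k) rewrite ι-mkℚ (suc k) | normalize-coprime {1} {k} (1-coprimeTo (suc k)) =
    ℚP.*-inverseˡ (mkℚ (+ suc k) 0 (coprime-sym (1-coprimeTo (suc k))))

  ι-∸ : ∀ {a b} → b ℕ.≤ a → ι (a ℕ.∸ b) ≡ ι a - ι b
  ι-∸ {a} {b} b≤a = begin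
    ι (a ℕ.∸ b)                      ≡⟨ lemma (ι b) (ι (a ℕ.∸ b)) ⟨
    ι b + ι (a ℕ.∸ b) - ι b      ≡⟨ cong (_- ι b) (ι-+ b (a ℕ.∸ b)) ⟨
    ι (b ℕ.+ (a ℕ.∸ b)) - ι b        ≡⟨ cong (λ t → ι t - ι b) (ℕP.m+[n∸m]≡n b≤a) ⟩
    ι a - ι b                      ∎
    where
    open ≡-Reasoning
    lemma : ∀ x y → x + y - x ≡ y
    lemma = solve-∀ ℚ-ring

  private
    ι-∣-∣-≥ : ∀ {a b} → b ℕ.≤ a → ι ℕ.∣ a - b ∣ ≡ ∣ ι a - ι b ∣
    ι-∣-∣-≥ {a} {b} b≤a = begin
      ι ℕ.∣ a - b ∣          ≡⟨ cong ι (ℕP.m≤n⇒∣n-m∣≡n∸m b≤a) ⟩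
      ι (a ℕ.∸ b)          ≡⟨ ℚP.0≤p⇒∣p∣≡p (ι-mono-≤ {0} {a ℕ.∸ b} ℕ.z≤n) ⟨
      ∣ ι (a ℕ.∸ b) ∣      ≡⟨ cong ∣_∣ (ι-∸ b≤a) ⟩
      ∣ ι a - ι b ∣      ∎
      where open ≡-Reasoning

  ι-∣-∣ : ∀ a b → ι ℕ.∣ a - b ∣ ≡ ∣ ι a - ι b ∣
  ι-∣-∣ a b with ℕP.≤-total b a
  ... | inj₁ b≤a = ι-∣-∣-≥ b≤a
  ... | inj₂ a≤b = begin
    ι ℕ.∣ a - b ∣               ≡⟨ cong ι (ℕP.∣-∣-comm a b) ⟩
    ι ℕ.∣ b - a ∣               ≡⟨ ι-∣-∣-≥ a≤b ⟩
    ∣ ι b - ι a ∣           ≡⟨ cong ∣_∣ (lemma (ι a) (ι b)) ⟩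
    ∣ ℚ.- (ι a - ι b) ∣     ≡⟨ ℚP.∣-p∣≡∣p∣ (ι a - ι b) ⟩
    ∣ ι a - ι b ∣           ∎
    where
    open ≡-Reasoning
    lemma : ∀ x y → y - x ≡ ℚ.- (x - y)
    lemma = solve-∀ ℚ-ring

  γ-identity : ∀ q → γ (suc q) * ι (suc q ℕ.^ 3) ≡ ι (q ℕ.^ 2 ℕ.* (q ℕ.+ 2))
  γ-identity q = begin
    γ p * ι (p ℕ.^ 3)
      ≡⟨ cong (γ p *_) (ι-^ p 3) ⟩
    (1ℚ - inv p - inv (p ℕ.^ 2) + inv (p ℕ.^ 3)) * (P * (P * (P * 1ℚ)))
      ≡⟨ lemma₁ (inv p) (inv (p ℕ.^ 2)) (inv (p ℕ.^ 3)) P ⟩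
    P * P * P - (inv p * P) * (P * P) - (inv (p ℕ.^ 2) * (P * (P * 1ℚ))) * P
      + inv (p ℕ.^ 3) * (P * (P * (P * 1ℚ)))
      ≡⟨ cong₂ (λ s t → P * P * P - s * (P * P) - t * P + inv (p ℕ.^ 3) * (P * (P * (P * 1ℚ))))
               (inv-ι p) (trans (cong (inv (p ℕ.^ 2) *_) (sym (ι-^ p 2))) (inv-ι (p ℕ.^ 2))) ⟩
    P * P * P - 1ℚ * (P * P) - 1ℚ * P + inv (p ℕ.^ 3) * (P * (P * (P * 1ℚ)))
      ≡⟨ cong (λ t → P * P * P - 1ℚ * (P * P) - 1ℚ * P + t)
              (trans (cong (inv (p ℕ.^ 3) *_) (sym (ι-^ p 3))) (inv-ι (p ℕ.^ 3))) ⟩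
    P * P * P - 1ℚ * (P * P) - 1ℚ * P + 1ℚ
      ≡⟨ cong (λ t → t * t * t - 1ℚ * (t * t) - 1ℚ * t + 1ℚ) (ι-+ 1 q) ⟩
    (1ℚ + Q) * (1ℚ + Q) * (1ℚ + Q) - 1ℚ * ((1ℚ + Q) * (1ℚ + Q)) - 1ℚ * (1ℚ + Q) + 1ℚ
      ≡⟨ lemma₂ Q ⟩
    Q * (Q * 1ℚ) * (Q + ι 2)
      ≡⟨ cong₂ _*_ (ι-^ q 2) (ι-+ q 2) ⟨
    ι (q ℕ.^ 2) * ι (q ℕ.+ 2)
      ≡⟨ ι-* (q ℕ.^ 2) (q ℕ.+ 2) ⟨
    ι (q ℕ.^ 2 ℕ.* (q ℕ.+ 2)) ∎
    where
    open ≡-Reasoning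
    p = suc q
    P = ι p
    Q = ι q
    lemma₁ : ∀ i₁ i₂ i₃ P → (1ℚ - i₁ - i₂ + i₃) * (P * (P * (P * 1ℚ)))
           ≡ P * P * P - (i₁ * P) * (P * P) - (i₂ * (P * (P * 1ℚ))) * P + i₃ * (P * (P * (P * 1ℚ)))
    lemma₁ = solve-∀ ℚ-ring
    lemma₂ : ∀ Q → (1ℚ + Q) * (1ℚ + Q) * (1ℚ + Q) - 1ℚ * ((1ℚ + Q) * (1ℚ + Q)) - 1ℚ * (1ℚ + Q) + 1ℚ
                 ≡ Q * (Q * 1ℚ) * (Q + ι 2)
    lemma₂ = solve-∀ ℚ-ring

  γ-bounds : ∀ q → 0ℚ ≤ γ (suc q) × γ (suc q) ≤ 1ℚ
  γ-bounds q = ℚP.*-cancelʳ-≤-pos P³ (subst₂ _≤_ (sym (ℚP.*-zeroˡ P³)) (sym (γ-identity q)) (ι-mono-≤ {0} {q ℕ.^ 2 ℕ.* (q ℕ.+ 2)} ℕ.z≤n))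
             , ℚP.*-cancelʳ-≤-pos P³ (subst₂ _≤_ (sym (γ-identity q)) (sym (ℚP.*-identityˡ P³)) (ι-mono-≤ γ′≤p³))
    where
    P³ = ι (suc q ℕ.^ 3)
    instance
      P³>0 : ℚ.Positive P³
      P³>0 = ℚ.positive (ι-pos (suc q ℕ.^ 3))
    γ′≤p³ : q ℕ.^ 2 ℕ.* (q ℕ.+ 2) ℕ.≤ suc q ℕ.^ 3
    γ′≤p³ = ℕP.≤-trans (ℕP.m≤m+n _ (suc q ℕ.^ 2 ℕ.+ q)) (ℕP.≤-reflexive (sym (p³-split q)))

  γ-estimate : ∀ q {G N} → ℕ.∣ suc q ℕ.^ 3 ℕ.* G - q ℕ.^ 2 ℕ.* (q ℕ.+ 2) ℕ.* N ℕ.^ 4 ∣ ℕ.≤ 4 ℕ.* suc q ℕ.^ 3 ℕ.* N ℕ.^ 3 →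
               ∣ ι G - γ (suc q) * ι N ^ℚ 4 ∣ ≤ ι 4 * ι N ^ℚ 3
  γ-estimate q {G} {N} estimate = ℚP.*-cancelˡ-≤-pos P³ (begin
    P³ * ∣ ι G - γ p * ν ^ℚ 4 ∣                       ≡⟨ cong (_* ∣ ι G - γ p * ν ^ℚ 4 ∣) (ℚP.0≤p⇒∣p∣≡p (ℚP.<⇒≤ (ι-pos (p ℕ.^ 3)))) ⟨
    ∣ P³ ∣ * ∣ ι G - γ p * ν ^ℚ 4 ∣                   ≡⟨ ℚP.∣p*q∣≡∣p∣*∣q∣ P³ _ ⟨
    ∣ P³ * (ι G - γ p * ν ^ℚ 4) ∣                     ≡⟨ cong ∣_∣ (lemma₁ P³ (ι G) (γ p) ν) ⟩
    ∣ P³ * ι G - γ p * P³ * ν ^ℚ 4 ∣                  ≡⟨ cong (λ t → ∣ P³ * ι G - t * ν ^ℚ 4 ∣) (γ-identity q) ⟩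
    ∣ P³ * ι G - ι γ′ * ν ^ℚ 4 ∣                      ≡⟨ cong (λ s → ∣ s - ι γ′ * ν ^ℚ 4 ∣) (ι-* (p ℕ.^ 3) G) ⟨
    ∣ ι (p ℕ.^ 3 ℕ.* G) - ι γ′ * ν ^ℚ 4 ∣             ≡⟨ cong (λ t → ∣ ι (p ℕ.^ 3 ℕ.* G) - ι γ′ * t ∣) (ι-^ N 4) ⟨
    ∣ ι (p ℕ.^ 3 ℕ.* G) - ι γ′ * ι (N ℕ.^ 4) ∣        ≡⟨ cong (λ t → ∣ ι (p ℕ.^ 3 ℕ.* G) - t ∣) (ι-* γ′ (N ℕ.^ 4)) ⟨
    ∣ ι (p ℕ.^ 3 ℕ.* G) - ι (γ′ ℕ.* N ℕ.^ 4) ∣        ≡⟨ ι-∣-∣ (p ℕ.^ 3 ℕ.* G) (γ′ ℕ.* N ℕ.^ 4) ⟨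
    ι ℕ.∣ p ℕ.^ 3 ℕ.* G - γ′ ℕ.* N ℕ.^ 4 ∣            ≤⟨ ι-mono-≤ estimate ⟩
    ι (4 ℕ.* p ℕ.^ 3 ℕ.* N ℕ.^ 3)                     ≡⟨ trans (ι-* (4 ℕ.* p ℕ.^ 3) (N ℕ.^ 3)) (cong₂ _*_ (ι-* 4 (p ℕ.^ 3)) (ι-^ N 3)) ⟩
    ι 4 * P³ * ν ^ℚ 3                                 ≡⟨ lemma₂ (ι 4) P³ ν ⟩
    P³ * (ι 4 * ν ^ℚ 3)                               ∎)
    where
    open ℚP.≤-Reasoning
    p = suc q
    ν = ι N
    P³ = ι (p ℕ.^ 3)
    γ′ = q ℕ.^ 2 ℕ.* (q ℕ.+ 2)
    instance
      P³>0 : ℚ.Positive P³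
      P³>0 = ℚ.positive (ι-pos (p ℕ.^ 3))
    lemma₁ : ∀ P G g ν → P * (G - g * (ν * (ν * (ν * (ν * 1ℚ))))) ≡ P * G - g * P * (ν * (ν * (ν * (ν * 1ℚ))))
    lemma₁ = solve-∀ ℚ-ring
    lemma₂ : ∀ c P ν → c * P * (ν * (ν * (ν * 1ℚ))) ≡ P * (c * (ν * (ν * (ν * 1ℚ))))
    lemma₂ = solve-∀ ℚ-ring

  floor-bracket : ∀ {x} → 0ℚ ≤ x → ∃ λ m → ι m ≤ x × x < ι (suc m)
  floor-bracket {mkℚ -[1+ _ ] _ _} (*≤* ())
  floor-bracket {mkℚ (+ A) d _} _ = A / D , lower , upper
    where
    D = suc d
    lower : ι (A / D) ≤ mkℚ (+ A) d _
    lower rewrite ι-mkℚ (A / D) = *≤* (subst₂ ℤ._≤_ (ℤP.pos-* (A / D) D) (ℤP.pos-* A 1)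
      (ℤ.+≤+ (ℕP.≤-trans (m/n*n≤m A D) (ℕP.≤-reflexive (sym (ℕP.*-identityʳ A))))))
    upper : mkℚ (+ A) d _ < ι (suc (A / D))
    upper rewrite ι-mkℚ (suc (A / D)) = *<* (subst₂ ℤ._<_ (ℤP.pos-* A 1) (ℤP.pos-* (suc (A / D)) D)
      (ℤ.+<+ (subst₂ ℕ._<_ (trans (sym (m≡m%n+[m/n]*n A D)) (sym (ℕP.*-identityʳ A))) refl
                            (ℕP.+-monoˡ-< (A / D ℕ.* D) (m%n<n A D)))))

  private
    ι≰nonPositive : ∀ k x .{{_ : ℚ.NonPositive x}} → ¬ ι (suc k) ≤ x
    ι≰nonPositive k x ι≤x = ℚP.<-irrefl refl (ℚP.<-≤-trans (ι-pos (suc k)) (ℚP.≤-trans ι≤x (ℚP.nonPositive⁻¹ x)))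

  ≤-∣ceiling∣ : ∀ k x → ι k ≤ x → k ℕ.≤ ℤ.∣ ceiling x ∣
  ≤-∣ceiling∣ zero    _                   _ = ℕ.z≤n
  ≤-∣ceiling∣ (suc k) x@(mkℚ -[1+ _ ] _ _) ι≤x = ⊥-elim (ι≰nonPositive k x ι≤x)
  ≤-∣ceiling∣ (suc k) x@(mkℚ +0 _ _)       ι≤x = ⊥-elim (ι≰nonPositive k x ι≤x)
  ≤-∣ceiling∣ (suc k) (mkℚ +[1+ n ] d _) ι≤x rewrite ι-mkℚ (suc k) with ι≤x
  ... | *≤* kD≤n = +≤⇒≤∣∣ (subst (λ Q → + suc k ℤ.≤ ℤ.- Q) (sym (div-pos-is-/ℕ -[1+ n ] (suc d))) k≤-Q)
    where
    Q = -[1+ n ] /ℕ suc d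
    Q≤-k : Q ℤ.≤ ℤ.- + suc k
    Q≤-k = ℤP.*-cancelʳ-≤-pos Q (ℤ.- + suc k) (+ suc d) (begin
      Q ℤ.* + suc d               ≤⟨ [n/ℕd]*d≤n -[1+ n ] (suc d) ⟩
      ℤ.- + suc n                 ≤⟨ ℤP.neg-mono-≤ (subst (+ suc k ℤ.* + suc d ℤ.≤_) (ℤP.*-identityʳ (+ suc n)) kD≤n) ⟩
      ℤ.- (+ suc k ℤ.* + suc d)   ≡⟨ ℤP.neg-distribˡ-* (+ suc k) (+ suc d) ⟩
      ℤ.- + suc k ℤ.* + suc d     ∎)
      where open ℤP.≤-Reasoning
    k≤-Q : + suc k ℤ.≤ ℤ.- Q
    k≤-Q = subst (ℤ._≤ ℤ.- Q) (ℤP.neg-involutive (+ suc k)) (ℤP.neg-mono-≤ Q≤-k)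
    +≤⇒≤∣∣ : ∀ {m i} → + m ℤ.≤ i → m ℕ.≤ ℤ.∣ i ∣
    +≤⇒≤∣∣ (ℤ.+≤+ m≤n) = m≤n

  private
    p≤r∧-p≤r⇒∣p∣≤r : ∀ {z r} → z ≤ r → ℚ.- z ≤ r → ∣ z ∣ ≤ r
    p≤r∧-p≤r⇒∣p∣≤r {z} z≤r -z≤r with ℚP.∣p∣≡p∨∣p∣≡-p z
    ... | inj₁ ∣z∣≡z  = subst (_≤ _) (sym ∣z∣≡z) z≤r
    ... | inj₂ ∣z∣≡-z = subst (_≤ _) (sym ∣z∣≡-z) -z≤r

    p≤q+r⇒p-q≤r : ∀ {a b c} → a ≤ b + c → a - b ≤ c
    p≤q+r⇒p-q≤r {a} {b} {c} a≤b+c = subst (a - b ≤_) (lemma b c) (ℚP.+-monoˡ-≤ (ℚ.- b) a≤b+c)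
      where
      lemma : ∀ b c → b + c - b ≡ c
      lemma = solve-∀ ℚ-ring

  side-length-bounds : ∀ m {x} → 1ℚ ≤ x → ι m ≤ x → x < ι (suc m) →
                ι (suc (2 ℕ.* m)) ≤ ι 3 * x × ∣ ι (suc (2 ℕ.* m)) - ι 2 * x ∣ ≤ 1ℚ
  side-length-bounds m {x} 1≤x lo hi = ν≤3x , p≤r∧-p≤r⇒∣p∣≤r (p≤q+r⇒p-q≤r ν≤1+2x) (subst (_≤ 1ℚ) (lemma₃ ν (ι 2 * x)) (p≤q+r⇒p-q≤r 2x≤ν+1))
    where
    ν = ι (suc (2 ℕ.* m))
    2* : ∀ {a b} → a ≤ b → ι 2 * a ≤ ι 2 * b
    2* = ℚP.*-monoˡ-≤-nonNeg (ι 2)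
    ν≡ : ν ≡ 1ℚ + ι 2 * ι m
    ν≡ = trans (ι-+ 1 (2 ℕ.* m)) (cong (λ t → 1ℚ + t) (ι-* 2 m))
    ν≤3x : ν ≤ ι 3 * x
    ν≤3x = subst₂ _≤_ (sym ν≡) (lemma₁ x) (ℚP.+-mono-≤ 1≤x (2* lo))
      where
      lemma₁ : ∀ x → x + ι 2 * x ≡ ι 3 * x
      lemma₁ = solve-∀ ℚ-ring
    ν≤1+2x : ν ≤ ι 2 * x + 1ℚ
    ν≤1+2x = subst₂ _≤_ (sym ν≡) (ℚP.+-comm 1ℚ (ι 2 * x)) (ℚP.+-monoʳ-≤ 1ℚ (2* lo))
    2x≤ν+1 : ι 2 * x ≤ ν + 1ℚ
    2x≤ν+1 = subst (ι 2 * x ≤_) (trans (cong (ι 2 *_) (ι-+ 1 m)) (trans (lemma₂ (ι m)) (cong (_+ 1ℚ) (sym ν≡)))) (2* (ℚP.<⇒≤ hi))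
      where
      lemma₂ : ∀ y → ι 2 * (1ℚ + y) ≡ 1ℚ + ι 2 * y + 1ℚ
      lemma₂ = solve-∀ ℚ-ring
    lemma₃ : ∀ a b → b - a ≡ ℚ.- (a - b)
    lemma₃ = solve-∀ ℚ-ring

  *-mono-≤-nonNeg : ∀ {a b c d} → 0ℚ ≤ a → a ≤ b → 0ℚ ≤ c → c ≤ d → a * c ≤ b * d
  *-mono-≤-nonNeg {a} {b} {c} {d} 0≤a a≤b 0≤c c≤d = ℚP.≤-trans
    (ℚP.*-monoˡ-≤-nonNeg a {{nonNegative 0≤a}} c≤d)
    (ℚP.*-monoʳ-≤-nonNeg d {{nonNegative (ℚP.≤-trans 0≤c c≤d)}} a≤b)

  *-nonNeg : ∀ {a b} → 0ℚ ≤ a → 0ℚ ≤ b → 0ℚ ≤ a * b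
  *-nonNeg {a} {b} 0≤a 0≤b = ℚP.nonNegative⁻¹ (a * b) {{ℚP.nonNeg*nonNeg⇒nonNeg a {{nonNegative 0≤a}} b {{nonNegative 0≤b}}}}

  +-nonNeg : ∀ {a b} → 0ℚ ≤ a → 0ℚ ≤ b → 0ℚ ≤ a + b
  +-nonNeg 0≤a 0≤b = ℚP.+-mono-≤ 0≤a 0≤b

  ^ℚ-nonNeg : ∀ {a} n → 0ℚ ≤ a → 0ℚ ≤ a ^ℚ n
  ^ℚ-nonNeg zero    0≤a = ℚP.nonNegative⁻¹ 1ℚ
  ^ℚ-nonNeg (suc n) 0≤a = *-nonNeg 0≤a (^ℚ-nonNeg n 0≤a)

  ^ℚ-mono-≤ : ∀ {a b} n → 0ℚ ≤ a → a ≤ b → a ^ℚ n ≤ b ^ℚ n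
  ^ℚ-mono-≤ zero    0≤a a≤b = ℚP.≤-refl
  ^ℚ-mono-≤ (suc n) 0≤a a≤b = *-mono-≤-nonNeg 0≤a a≤b (^ℚ-nonNeg n 0≤a) (^ℚ-mono-≤ n 0≤a a≤b)

  private
    cube-≤ : ∀ {u v w c} → 0ℚ ≤ u → 0ℚ ≤ v → 0ℚ ≤ w → u ≤ c → v ≤ c → w ≤ c → u * v * w ≤ c * c * c
    cube-≤ 0≤u 0≤v 0≤w u≤c v≤c w≤c =
      *-mono-≤-nonNeg (*-nonNeg 0≤u 0≤v) (*-mono-≤-nonNeg 0≤u u≤c 0≤v v≤c) 0≤w w≤c

  ∣a⁴-b⁴∣≤4c³∣a-b∣ : ∀ {a b c} → 0ℚ ≤ a → 0ℚ ≤ b → a ≤ c → b ≤ c →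
                     ∣ a ^ℚ 4 - b ^ℚ 4 ∣ ≤ ι 4 * c ^ℚ 3 * ∣ a - b ∣
  ∣a⁴-b⁴∣≤4c³∣a-b∣ {a} {b} {c} 0≤a 0≤b a≤c b≤c = begin
    ∣ a ^ℚ 4 - b ^ℚ 4 ∣         ≡⟨ cong ∣_∣ (factor a b) ⟩
    ∣ (a - b) * S ∣             ≡⟨ ℚP.∣p*q∣≡∣p∣*∣q∣ (a - b) S ⟩
    ∣ a - b ∣ * ∣ S ∣           ≡⟨ cong (∣ a - b ∣ *_) (ℚP.0≤p⇒∣p∣≡p 0≤S) ⟩
    ∣ a - b ∣ * S               ≤⟨ ℚP.*-monoˡ-≤-nonNeg ∣ a - b ∣ {{ℚP.∣-∣-nonNeg (a - b)}} S≤ ⟩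
    ∣ a - b ∣ * (ι 4 * c ^ℚ 3)  ≡⟨ ℚP.*-comm ∣ a - b ∣ _ ⟩
    ι 4 * c ^ℚ 3 * ∣ a - b ∣    ∎
    where
    open ℚP.≤-Reasoning
    S = a * a * a + a * a * b + a * b * b + b * b * b
    factor : ∀ a b → a * (a * (a * (a * 1ℚ))) - b * (b * (b * (b * 1ℚ)))
                     ≡ (a - b) * (a * a * a + a * a * b + a * b * b + b * b * b)
    factor = solve-∀ ℚ-ring
    0≤S : 0ℚ ≤ S
    0≤S = +-nonNeg (+-nonNeg (+-nonNeg (cube 0≤a 0≤a 0≤a) (cube 0≤a 0≤a 0≤b)) (cube 0≤a 0≤b 0≤b)) (cube 0≤b 0≤b 0≤b)
      where
      cube : ∀ {u v w} → 0ℚ ≤ u → 0ℚ ≤ v → 0ℚ ≤ w → 0ℚ ≤ u * v * w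
      cube 0≤u 0≤v 0≤w = *-nonNeg (*-nonNeg 0≤u 0≤v) 0≤w
    S≤ : S ≤ ι 4 * c ^ℚ 3
    S≤ = ℚP.≤-trans (ℚP.+-mono-≤ (ℚP.+-mono-≤ (ℚP.+-mono-≤ (cube-≤ 0≤a 0≤a 0≤a a≤c a≤c a≤c) (cube-≤ 0≤a 0≤a 0≤b a≤c a≤c b≤c))
                                                        (cube-≤ 0≤a 0≤b 0≤b a≤c b≤c b≤c))
                                              (cube-≤ 0≤b 0≤b 0≤b b≤c b≤c b≤c))
                    (ℚP.≤-reflexive (four-cubes c))
      where
      four-cubes : ∀ c → c * c * c + c * c * c + c * c * c + c * c * c ≡ ι 4 * (c * (c * (c * 1ℚ)))
      four-cubes = solve-∀ ℚ-ring

  quartic-transfer : ∀ {G g ν x} → 0ℚ ≤ g → g ≤ 1ℚ → 0ℚ ≤ ν → 0ℚ ≤ x → ν ≤ ι 3 * x → ∣ ν - ι 2 * x ∣ ≤ 1ℚ →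
                     ∣ G - g * ν ^ℚ 4 ∣ ≤ ι 4 * ν ^ℚ 3 → ∣ G - ι 16 * g * x ^ℚ 4 ∣ ≤ ι 216 * x ^ℚ 3
  quartic-transfer {G} {g} {ν} {x} 0≤g g≤1 0≤ν 0≤x ν≤3x ∣ν-2x∣≤1 G≈ = begin
    ∣ G - ι 16 * g * x ^ℚ 4 ∣                              ≡⟨ cong ∣_∣ (split G g ν x) ⟩
    ∣ (G - g * ν ^ℚ 4) + g * (ν ^ℚ 4 - y ^ℚ 4) ∣           ≤⟨ ℚP.∣p+q∣≤∣p∣+∣q∣ (G - g * ν ^ℚ 4) (g * (ν ^ℚ 4 - y ^ℚ 4)) ⟩
    ∣ G - g * ν ^ℚ 4 ∣ + ∣ g * (ν ^ℚ 4 - y ^ℚ 4) ∣          ≤⟨ ℚP.+-mono-≤ G≈ quartic-error ⟩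
    ι 4 * ν ^ℚ 3 + ι 4 * t ^ℚ 3                            ≤⟨ ℚP.+-monoˡ-≤ _ (ℚP.*-monoˡ-≤-nonNeg (ι 4) (^ℚ-mono-≤ 3 0≤ν ν≤3x)) ⟩
    ι 4 * t ^ℚ 3 + ι 4 * t ^ℚ 3                            ≡⟨ total x ⟩
    ι 216 * x ^ℚ 3                                         ∎
    where
    open ℚP.≤-Reasoning
    y = ι 2 * x
    t = ι 3 * x
    0≤y : 0ℚ ≤ y
    0≤y = *-nonNeg (ι-mono-≤ {0} {2} ℕ.z≤n) 0≤x
    y≤t : y ≤ t
    y≤t = ℚP.*-monoʳ-≤-nonNeg x {{nonNegative 0≤x}} (ι-mono-≤ {2} {3} (ℕ.s≤s (ℕ.s≤s ℕ.z≤n)))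
    quartic-error : ∣ g * (ν ^ℚ 4 - y ^ℚ 4) ∣ ≤ ι 4 * t ^ℚ 3
    quartic-error = begin
      ∣ g * (ν ^ℚ 4 - y ^ℚ 4) ∣              ≡⟨ ℚP.∣p*q∣≡∣p∣*∣q∣ g _ ⟩
      ∣ g ∣ * ∣ ν ^ℚ 4 - y ^ℚ 4 ∣            ≡⟨ cong (_* ∣ ν ^ℚ 4 - y ^ℚ 4 ∣) (ℚP.0≤p⇒∣p∣≡p 0≤g) ⟩
      g * ∣ ν ^ℚ 4 - y ^ℚ 4 ∣                ≤⟨ ℚP.*-monoʳ-≤-nonNeg ∣ ν ^ℚ 4 - y ^ℚ 4 ∣ {{ℚP.∣-∣-nonNeg (ν ^ℚ 4 - y ^ℚ 4)}} g≤1 ⟩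
      1ℚ * ∣ ν ^ℚ 4 - y ^ℚ 4 ∣               ≡⟨ ℚP.*-identityˡ _ ⟩
      ∣ ν ^ℚ 4 - y ^ℚ 4 ∣                    ≤⟨ ∣a⁴-b⁴∣≤4c³∣a-b∣ 0≤ν 0≤y ν≤3x y≤t ⟩
      ι 4 * t ^ℚ 3 * ∣ ν - y ∣               ≤⟨ ℚP.*-monoˡ-≤-nonNeg (ι 4 * t ^ℚ 3) {{nonNegative (*-nonNeg (ι-mono-≤ {0} {4} ℕ.z≤n) (^ℚ-nonNeg 3 (ℚP.≤-trans 0≤ν ν≤3x)))}} ∣ν-2x∣≤1 ⟩
      ι 4 * t ^ℚ 3 * 1ℚ                      ≡⟨ ℚP.*-identityʳ _ ⟩
      ι 4 * t ^ℚ 3                           ∎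
    split : ∀ G g ν x → G - ι 16 * g * (x * (x * (x * (x * 1ℚ))))
            ≡ (G - g * (ν * (ν * (ν * (ν * 1ℚ))))) + g * (ν * (ν * (ν * (ν * 1ℚ))) - ι 2 * x * (ι 2 * x * (ι 2 * x * (ι 2 * x * 1ℚ))))
    split = solve-∀ ℚ-ring
    total : ∀ x → ι 4 * (ι 3 * x * (ι 3 * x * (ι 3 * x * 1ℚ))) + ι 4 * (ι 3 * x * (ι 3 * x * (ι 3 * x * 1ℚ)))
                  ≡ ι 216 * (x * (x * (x * 1ℚ)))
    total = solve-∀ ℚ-ring

open Rationals

module BoxCount where
  open import Data.Nat as ℕ using (ℕ; zero; suc; _+_; _≤?_)
  open import Data.Nat.Primality using (Prime)
  import Data.Nat.Properties as ℕP
  open import Data.Nat.Divisibility using (_∣?_)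
  open import Data.Nat.ListAction using (sum)
  open import Data.Integer as ℤ using (ℤ; +_)
  import Data.Integer.Properties as ℤP
  open import Data.List using (List; []; _∷_; _++_; map; applyUpTo; concatMap; filter; length)
  open import Data.List.Properties using (length-++; filter-++)
  open import Data.Rational as ℚ using (ℚ; 0ℚ; 1ℚ; _≤_; _<_; _-_; _*_; ∣_∣)
  import Data.Rational.Properties as ℚP
  open import Data.Empty using (⊥-elim)
  open import Data.Product using (∃; _×_; _,_; proj₁; proj₂)
  open import Function using (_⇔_; mk⇔; Equivalence)
  open import Relation.Nullary using (yes; no; ¬?; _×-dec_)
  open import Relation.Unary using (Decidable)
  open import Relation.Binary.PropositionalEquality

  module _ {A : Set} {P : A → Set} (P? : Decidable P) where
    length-filter-concatMap : ∀ {B : Set} (g : B → List A) xs →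
      length (filter P? (concatMap g xs)) ≡ sum (map (λ x → length (filter P? (g x))) xs)
    length-filter-concatMap g []       = refl
    length-filter-concatMap g (x ∷ xs) = begin
      length (filter P? (g x ++ concatMap g xs))                         ≡⟨ cong length (filter-++ P? (g x) _) ⟩
      length (filter P? (g x) ++ filter P? (concatMap g xs))              ≡⟨ length-++ (filter P? (g x)) ⟩
      length (filter P? (g x)) + length (filter P? (concatMap g xs))      ≡⟨ cong (λ t → length (filter P? (g x)) + t) (length-filter-concatMap g xs) ⟩
      length (filter P? (g x)) + sum (map (λ x → length (filter P? (g x))) xs) ∎
      where open ≡-Reasoning

    length-filter-map : ∀ {B : Set} (g : B → A) xs → length (filter P? (map g xs)) ≡ sum (map (λ x → 𝟙 (P? (g x))) xs)
    length-filter-map g []       = refl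
    length-filter-map g (x ∷ xs) with P? (g x)
    ... | yes _ = cong suc (length-filter-map g xs)
    ... | no  _ = length-filter-map g xs

  ∑<-applyUpTo : ∀ (f : ℤ → ℕ) (e : ℕ → ℤ) (g : ℕ → ℕ) L → sum (map f (map e (applyUpTo g L))) ≡ ∑< L (λ i → f (e (g i)))
  ∑<-applyUpTo f e g zero    = refl
  ∑<-applyUpTo f e g (suc L) = cong (λ t → f (e (g 0)) + t) (∑<-applyUpTo f e (λ i → g (suc i)) L)

  opaque
    unfolding ∑±

    sum-range≡∑± : ∀ n f → sum (map f (range n)) ≡ ∑± n f
    sum-range≡∑± n f = trans (∑<-applyUpTo f (λ k → + k ℤ.- + n) (λ i → i) (suc (2 ℕ.* n)))
                             (∑<-cong (suc (2 ℕ.* n)) λ i → cong f (ℤP.+-comm (+ i) (ℤ.- + n)))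

  length-filter-box : ∀ {P : M2 → Set} (P? : Decidable P) n →
                      length (filter P? (box n)) ≡ ∑±⁴ n (λ a b c d → 𝟙 (P? (mk a b c d)))
  length-filter-box P? n =
    trans (length-filter-concatMap P? row₁ R) (trans (sum-range≡∑± n _) (∑±-cong λ a →
    trans (length-filter-concatMap P? (row₂ a) R) (trans (sum-range≡∑± n _) (∑±-cong λ b →
    trans (length-filter-concatMap P? (row₃ a b) R) (trans (sum-range≡∑± n _) (∑±-cong λ c →
    trans (length-filter-map P? (mk a b c) R) (sum-range≡∑± n _)))))))
    where
    open ∑±-Properties n
    R = range n
    row₃ : ℤ → ℤ → ℤ → List M2
    row₃ a b c = map (mk a b c) R
    row₂ : ℤ → ℤ → List M2
    row₂ a b = concatMap (row₃ a b) R
    row₁ : ℤ → List M2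
    row₁ a = concatMap (row₂ a) R

  module _ (p : ℕ) {x : ℚ} (m : ℕ) (lo : ι m ≤ x) (hi : x < ι (suc m)) where
    ι≤x⇔≤m : ∀ k → ι k ≤ x ⇔ k ℕ.≤ m
    ι≤x⇔≤m k = mk⇔ to (λ k≤m → ℚP.≤-trans (ι-mono-≤ k≤m) lo)
      where
      to : ι k ≤ x → k ℕ.≤ m
      to ι≤x with k ≤? m
      ... | yes k≤m = k≤m
      ... | no  k≰m = ⊥-elim (ℚP.<-irrefl refl (ℚP.<-≤-trans hi (ℚP.≤-trans (ι-mono-≤ (ℕP.≰⇒> k≰m)) ι≤x)))

    height≤⇔ : ∀ a b c d → h (mk a b c d) ℕ.≤ m ⇔ (ℤ.∣ a ∣ ℕ.≤ m × (ℤ.∣ b ∣ ℕ.≤ m × (ℤ.∣ c ∣ ℕ.≤ m × ℤ.∣ d ∣ ℕ.≤ m)))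
    height≤⇔ a b c d = mk⇔
      (λ h≤m → let abc≤m = ℕP.m⊔n≤o⇒m≤o _ _ h≤m ; ab≤m = ℕP.m⊔n≤o⇒m≤o _ _ abc≤m in
        ℕP.m⊔n≤o⇒m≤o _ _ ab≤m , ℕP.m⊔n≤o⇒n≤o _ _ ab≤m , ℕP.m⊔n≤o⇒n≤o _ _ abc≤m , ℕP.m⊔n≤o⇒n≤o _ _ h≤m)
      (λ (a≤m , b≤m , c≤m , d≤m) → ℕP.⊔-lub (ℕP.⊔-lub (ℕP.⊔-lub a≤m b≤m) c≤m) d≤m)

    𝟙-Cond : ∀ a b c d → 𝟙 (Cond? p x (mk a b c d)) ≡
      within m a ℕ.* (within m b ℕ.* (within m c ℕ.* (within m d ℕ.* 𝟙 (¬? (p ∣? ℤ.∣ a ℤ.* d ℤ.- b ℤ.* c ∣)))))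
    𝟙-Cond a b c d = trans (𝟙-cong (Cond? p x (mk a b c d)) (a? ×-dec (b? ×-dec (c? ×-dec (d? ×-dec p∤?)))) (mk⇔ to from))
      (trans (𝟙-× a? _) (cong (𝟙 a? ℕ.*_) (trans (𝟙-× b? _) (cong (𝟙 b? ℕ.*_) (trans (𝟙-× c? _) (cong (𝟙 c? ℕ.*_) (𝟙-× d? p∤?)))))))
      where
      a? = ℤ.∣ a ∣ ≤? m
      b? = ℤ.∣ b ∣ ≤? m
      c? = ℤ.∣ c ∣ ≤? m
      d? = ℤ.∣ d ∣ ≤? m
      p∤? = ¬? (p ∣? ℤ.∣ a ℤ.* d ℤ.- b ℤ.* c ∣)
      to : Cond p x (mk a b c d) → _
      to (ι≤x , p∤det) with Equivalence.to (height≤⇔ a b c d) (Equivalence.to (ι≤x⇔≤m _) ι≤x)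
      ... | a≤m , b≤m , c≤m , d≤m = a≤m , b≤m , c≤m , d≤m , p∤det
      from : _ → Cond p x (mk a b c d)
      from (a≤m , b≤m , c≤m , d≤m , p∤det) = Equivalence.from (ι≤x⇔≤m _) (Equivalence.from (height≤⇔ a b c d) (a≤m , b≤m , c≤m , d≤m)) , p∤det

    count≡nonsingular : count p x ≡ nonsingular p m
    count≡nonsingular = begin
      count p x                                              ≡⟨ length-filter-box (Cond? p x) n ⟩
      ∑±⁴ n (λ a b c d → 𝟙 (Cond? p x (mk a b c d)))        ≡⟨ ∑±⁴-cong 𝟙-Cond ⟩
      ∑±⁴ n (λ a b c d → within m a ℕ.* (within m b ℕ.* (within m c ℕ.* (within m d ℕ.* Ψ a b c d))))
                                                             ≡⟨ ∑±⁴-within Ψ (≤-∣ceiling∣ m x lo) ⟩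
      nonsingular p m                                        ∎
      where
      open ≡-Reasoning
      n = ℤ.∣ ℚ.ceiling x ∣
      open ∑±⁴-Properties n
      Ψ : ℤ → ℤ → ℤ → ℤ → ℕ
      Ψ a b c d = 𝟙 (¬? (p ∣? ℤ.∣ a ℤ.* d ℤ.- b ℤ.* c ∣))

  bracketed-estimate : ∀ q → Prime (suc q) → ∀ {x} → 1ℚ ≤ x → ∃ (λ m → ι m ≤ x × x < ι (suc m)) →
                       ∣ ι (count (suc q) x) - ι 16 * γ (suc q) * x ^ℚ 4 ∣ ≤ ι 216 * x ^ℚ 3
  bracketed-estimate q p-prime {x} 1≤x (m , lo , hi) =
    quartic-transfer {ι (count p x)} {γ p} {ι N} {x} γ≥0 γ≤1 (ι-mono-≤ {0} {N} ℕ.z≤n) 0≤x ν≤3x ∣ν-2x∣≤1 count≈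
    where
    open SingularCount p-prime m
    0≤x : 0ℚ ≤ x
    0≤x = ℚP.≤-trans (ι-mono-≤ {0} {1} ℕ.z≤n) 1≤x
    γ≥0 : 0ℚ ≤ γ p
    γ≥0 = proj₁ (γ-bounds q)
    γ≤1 : γ p ≤ 1ℚ
    γ≤1 = proj₂ (γ-bounds q)
    ν≤3x : ι N ≤ ι 3 * x
    ν≤3x = proj₁ (side-length-bounds m 1≤x lo hi)
    ∣ν-2x∣≤1 : ∣ ι N - ι 2 * x ∣ ≤ 1ℚ
    ∣ν-2x∣≤1 = proj₂ (side-length-bounds m 1≤x lo hi)
    count≈ : ∣ ι (count p x) - γ p * ι N ^ℚ 4 ∣ ≤ ι 4 * ι N ^ℚ 3
    count≈ = subst (λ G → ∣ ι G - γ p * ι N ^ℚ 4 ∣ ≤ ι 4 * ι N ^ℚ 3) (sym (count≡nonsingular p m lo hi))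
      (γ-estimate q {nonsingular p m} {N}
        (nonsingular-estimate q {N} {zeros} {singular} {nonsingular p m} zeros-count singular-count nonsingular+singular))

open BoxCount

open import Data.Nat using (ℕ; zero; suc)
open import Data.Nat.Primality using (Prime)
open import Data.Integer using (+_)
open import Data.Rational using (ℚ; _≤_; _-_; _*_; _/_; ∣_∣; 1ℚ)
open import Data.Product using (∃)
open import Relation.Binary.PropositionalEquality using (_≢_)

import Data.Nat as ℕ
open import Data.Nat.Primality using (¬prime[0])
import Data.Rational.Properties as ℚP
open import Data.Empty using (⊥-elim)
open import Data.Product using (_,_)

lemma6p5 : ∃ λ (C : ℕ) → ∀ (p : ℕ) → Prime p → p ≢ 2 → ∀ (x : ℚ) → 1ℚ ≤ x →
    ∣ (+ count p x / 1) - (+ 16 / 1) * γ p * (x ^ℚ 4) ∣ ≤ (+ C / 1) * (x ^ℚ 3)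
lemma6p5 = 216 , estimate
  where
  estimate : ∀ p → Prime p → p ≢ 2 → ∀ x → 1ℚ ≤ x → ∣ ι (count p x) - ι 16 * γ p * x ^ℚ 4 ∣ ≤ ι 216 * x ^ℚ 3
  estimate zero    p-prime = ⊥-elim (¬prime[0] p-prime)
  estimate (suc q) p-prime _ x 1≤x = bracketed-estimate q p-prime 1≤x (floor-bracket (ℚP.≤-trans (ι-mono-≤ {0} {1} ℕ.z≤n) 1≤x))
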